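{- Let $\alpha,\beta$ be omega-regular expressions of the same sort (both regular expressions, or both $\omega$-regular expressions). Then $L(\alpha)\subseteq L(\beta)$ if and only if the sequent $\alpha\vdash\beta$ is derivable in $\mathbf{L}$.
   Context: Formulae. Fix two disjoint countable sets of variables $\mathrm{Var}_\ast$ and $\mathrm{Var}_\omega$. Finite formulae $F$ and $\omega$-formulae $\Omega$ are given by $F ::= \mathrm{Var}_\ast \mid F\cdot F \mid F\backslash F \mid F/F \mid F\vee F \mid F\wedge F \mid \Omega/\Omega \mid F^\ast$, $\Omega ::= \mathrm{Var}_\omega \mid F\cdot\Omega \mid F\backslash\Omega \mid \Omega\vee\Omega \mid \Omega\wedge\Omega \mid F^\omega$. Omega-regular expressions are the formulae built using only $\cdot,\vee,{}^\ast,{}^\omega$ from variables in $\mathrm{Var}_\ast$: regular expressions $E ::= \mathrm{Var}_\ast \mid E\cdot E\mid E\vee E\mid E^\ast$ and $\omega$-regular expressions $R ::= E\cdot R\mid R\vee R\mid E^\omega$. Their language semantics over the alphabet $\mathrm{Var}_\ast$: $L(x)=\{x\}$, $L(A\cdot B)=\{uv\mid u\in L(A),v\in L(B)\}$ (with $u$ finite), $L(A\vee B)=L(A)\cup L(B)$, $L(A^\ast)=\{u_1\cdots u_n\mid n\ge0,u_i\in L(A)\}$, $L(A^\omega)=\{u_0u_1u_2\cdots\mid u_i\in L(A)\setminus\{\varepsilon\}\}$ (a set of infinite words). So regular expressions denote languages of finite words and $\omega$-regular expressions denote sets of infinite words. Sequences and sequents. A type-1 sequence is a finite (possibly empty) sequence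 $A_1,\dots,A_n$ of finite formulae; a type-2 sequence is an $\omega$-sequence $A_1,A_2,\dots$ of finite formulae; a type-3 sequence is $A_1,\dots,A_n,C$ with $n\ge 0$, $A_i$ finite formulae and $C$ an $\omega$-formula. A correct sequence is one of these three types. A sequent is $\Theta\vdash B$ where either $\Theta$ is type-1 and $B$ is a finite formula, or $\Theta$ is type-2 or type-3 and $B$ is an $\omega$-formula. Commas denote concatenation; $\langle \Gamma_i\rangle_{i<\alpha}$ denotes $\Gamma_0,\Gamma_1,\dots$; $A^n$ denotes $n$ copies of $A$ and $\langle A\rangle_{n\in\omega}$ denotes $A,A,A,\dots$. The calculus $\mathbf{L}$. Below $\Gamma,\Pi,\Pi_i,\Gamma_i,\Delta_i$ range over type-1 sequences, $\Theta,\Xi$ over arbitrary (possibly empty) sequences, and a rule instance is allowed only when all displayed expressions are sequents. Axioms: $A\vdash A$. Left rules: $(\cdot L)$ from $\Gamma,A,B,\Theta\vdash E$ infer $\Gamma,A\cdot B,\Theta\vdash E$; $(\backslash L)$ from $\Gamma,A,\Theta\vdash E$ and $\Pi\vdash B$ infer $\Gamma,\Pi,B\backslash A,\Theta\vdash E$; $(/L)$ from $\Gamma,A,\Theta\vdash E$ and $\Xi\vdash D$ infer $\Gamma,A/D,\Xi,\Theta\vdash E$; $(\wedge L)$ from $\Gamma,A_i,\Theta\vdash E$ ($i\in\{1,2\}$) infer $\Gamma,A_1\wedge A_2,\Theta\vdash E$; $(\vee L)$ from $\Gamma,A_1,\Theta\vdash E$ and $\Gamma,A_2,\Theta\vdash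 E$ infer $\Gamma,A_1\vee A_2,\Theta\vdash E$; $(^\ast L)$ from $\Gamma,A^n,\Theta\vdash E$ for all $n\in\omega$ infer $\Gamma,A^\ast,\Theta\vdash E$; $(^\omega L)$ from $\Gamma,\langle A\rangle_{n\in\omega}\vdash E$ infer $\Gamma,A^\omega\vdash E$. For a correct sequence $\Theta$ and a set $M$ of correct sequences of the same type, write $\Theta\Vdash M$ if there is a derivation of $\Theta\vdash x$ ($x$ a fresh variable) from axioms and the hypotheses $\{\Xi\vdash x\mid \Xi\in M\}$ that uses all these hypotheses and only the left rules just listed. Rule $(L_\omega)$: from $\Delta_i\Vdash M_i$ for all $i<\omega$ and $\langle\Gamma_i\rangle_{i<\omega}\vdash C$ for every choice of $\Gamma_i\in M_i$ ($i<\omega$), infer $\langle\Delta_i\rangle_{i<\omega}\vdash C$. Right rules: $(^\omega R)$ from $\Gamma_i\vdash A$ for all $i<\omega$ infer $\langle\Gamma_i\rangle_{i<\omega}\vdash A^\omega$; $(/R)$ from $\Pi,B\vdash A$ infer $\Pi\vdash A/B$; $(\backslash R)$ from $B,\Theta\vdash A$ infer $\Theta\vdash B\backslash A$; $(\cdot R)$ from $\Gamma\vdash A$ and $\Theta\vdash B$ infer $\Gamma,\Theta\vdash A\cdot B$; $(\wedge R)$ from $\Theta\vdash A_1$ and $\Theta\vdash A_2$ infer $\Theta\vdash A_1\wedge A_2$; $(\vee R_i)$ from $\Theta\vdash A_i$ infer $\Theta\vdash A_1\vee A_2$; $(^\ast R_n)$ for each $n\in\omega$, from $\Pi_i\vdash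 A$ for all $i<n$ infer $\langle\Pi_i\rangle_{i<n}\vdash A^\ast$. A sequent is derivable in $\mathbf{L}$ if it is the root of a well-founded (possibly infinitely branching) tree built from these axioms and rules. -}

module Defs where

open import Data.Nat using (ℕ; zero; suc; _+_; _<_)
open import Data.Fin using (Fin; toℕ)
open import Data.List using (List; []; _∷_; _++_; [_]; length; lookup; concat; replicate; tabulate)
open import Data.List.Relation.Unary.All using (All)
open import Data.Product using (Σ; ∃; ∃-syntax; _×_; _,_)
open import Data.Sum using (_⊎_)
open import Relation.Binary.PropositionalEquality using (_≡_; _≢_)
open import Function.Bundles using (_⇔_)
open import Level using (Level)

-- Formulae.  Var_* = ℕ (constructor var), Var_ω = ℕ (constructor ovar);
-- the two sets are disjoint since they are different constructors.
-- `Fm fin` = finite formulae F, `Fm omg` = ω-formulae Ω.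

data Ty : Set where
  fin omg : Ty

infixl 30 _·_
infixr 29 _⧵_
infixl 29 _/_
infixl 28 _∧_
infixl 27 _∨_
infix 35 _⋆ _^ω

data Fm : Ty → Set where
  var  : ℕ → Fm fin
  ovar : ℕ → Fm omg
  _·_  : ∀ {t} → Fm fin → Fm t → Fm t
  _⧵_  : ∀ {t} → Fm fin → Fm t → Fm t
  _/_  : ∀ {t} → Fm t → Fm t → Fm fin
  _∨_  : ∀ {t} → Fm t → Fm t → Fm t
  _∧_  : ∀ {t} → Fm t → Fm t → Fm t
  _⋆   : Fm fin → Fm fin
  _^ω  : Fm fin → Fm omg

Stream : Set → Set
Stream A = ℕ → A

_++ˢ_ : {A : Set} → List A → Stream A → Stream A
([] ++ˢ f) n = f n
((x ∷ xs) ++ˢ f) zero = x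
((x ∷ xs) ++ˢ f) (suc n) = (xs ++ˢ f) n

pos : {A : Set} → (ℕ → List A) → ℕ → ℕ
pos Γ zero = 0
pos Γ (suc i) = pos Γ i + length (Γ i)

-- `IsConcat Γ f` : the sequence ⟨Γ_i⟩_{i<ω} is an ω-sequence (the blocks
-- cover all positions, i.e. infinitely many Γ_i are nonempty) and equals f.
IsConcat : {A : Set} → (ℕ → List A) → Stream A → Set
IsConcat Γ f =
  (∀ n → ∃[ i ] (n < pos Γ i)) ×
  (∀ i (j : Fin (length (Γ i))) → f (pos Γ i + toℕ j) ≡ lookup (Γ i) j)

-- Correct sequences and sequents.
-- Ante fin = type-1 sequences; Ante omg = type-2 (⟪_⟫ω) or type-3 (⟪_∣_⟫).

data Ante : Ty → Set where
  ⟪_⟫   : List (Fm fin) → Ante fin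
  ⟪_⟫ω  : Stream (Fm fin) → Ante omg
  ⟪_∣_⟫ : List (Fm fin) → Fm omg → Ante omg

infix 5 _⊢_
data Sequent : Set where
  _⊢_ : ∀ {t} → Ante t → Fm t → Sequent

prepend : ∀ {t} → List (Fm fin) → Ante t → Ante t
prepend Γ ⟪ Δ ⟫ = ⟪ Γ ++ Δ ⟫
prepend Γ ⟪ f ⟫ω = ⟪ Γ ++ˢ f ⟫ω
prepend Γ ⟪ Δ ∣ C ⟫ = ⟪ Γ ++ Δ ∣ C ⟫

snoc : ∀ {t} → List (Fm fin) → Fm t → Ante t
snoc {fin} Π B = ⟪ Π ++ [ B ] ⟫
snoc {omg} Π B = ⟪ Π ∣ B ⟫

-- Derivations of type-1 sequents using axioms and left rules only
-- (the side premises inside a ⊩-derivation).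

data LD : List (Fm fin) → Fm fin → Set where
  ax  : (A : Fm fin) → LD [ A ] A
  ·L  : ∀ {Γ A B Θ E} → LD (Γ ++ A ∷ B ∷ Θ) E → LD (Γ ++ A · B ∷ Θ) E
  ⧵L  : ∀ {Γ Π A B Θ E} → LD (Γ ++ A ∷ Θ) E → LD Π B → LD (Γ ++ Π ++ B ⧵ A ∷ Θ) E
  /L  : ∀ {Γ Ξ A D Θ E} → LD (Γ ++ A ∷ Θ) E → LD Ξ D → LD (Γ ++ A / D ∷ Ξ ++ Θ) E
  ∧L₁ : ∀ {Γ A₁ A₂ Θ E} → LD (Γ ++ A₁ ∷ Θ) E → LD (Γ ++ A₁ ∧ A₂ ∷ Θ) E
  ∧L₂ : ∀ {Γ A₁ A₂ Θ E} → LD (Γ ++ A₂ ∷ Θ) E → LD (Γ ++ A₁ ∧ A₂ ∷ Θ) E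
  ∨L  : ∀ {Γ A₁ A₂ Θ E} → LD (Γ ++ A₁ ∷ Θ) E → LD (Γ ++ A₂ ∷ Θ) E →
        LD (Γ ++ A₁ ∨ A₂ ∷ Θ) E
  ⋆L  : ∀ {Γ A Θ E} → (∀ n → LD (Γ ++ replicate n A ++ Θ) E) → LD (Γ ++ A ⋆ ∷ Θ) E

-- Θ ⊩ M  for a type-1 sequence Θ and a set M of type-1 sequences:
-- a derivation of Θ ⊢ x (x fresh) from the hypotheses {Ξ ⊢ x | Ξ ∈ M},
-- using only axioms and left rules, in which the set of hypotheses used
-- is exactly M.  Since x is fresh, the branch carrying x can only end in
-- hypotheses, and side premises cannot use hypotheses (they are LD).

Pred : Set₁
Pred = List (Fm fin) → Set

infix 4 _⊩_
data _⊩_ : List (Fm fin) → Pred → Set₁ where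
  hyp : ∀ {Θ} {M : Pred} → (∀ Ξ → M Ξ ⇔ (Ξ ≡ Θ)) → Θ ⊩ M
  ·L  : ∀ {Γ A B Θ M} → (Γ ++ A ∷ B ∷ Θ) ⊩ M → (Γ ++ A · B ∷ Θ) ⊩ M
  ⧵L  : ∀ {Γ Π A B Θ M} → (Γ ++ A ∷ Θ) ⊩ M → LD Π B → (Γ ++ Π ++ B ⧵ A ∷ Θ) ⊩ M
  /L  : ∀ {Γ Ξ A D Θ M} → (Γ ++ A ∷ Θ) ⊩ M → LD Ξ D → (Γ ++ A / D ∷ Ξ ++ Θ) ⊩ M
  ∧L₁ : ∀ {Γ A₁ A₂ Θ M} → (Γ ++ A₁ ∷ Θ) ⊩ M → (Γ ++ A₁ ∧ A₂ ∷ Θ) ⊩ M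
  ∧L₂ : ∀ {Γ A₁ A₂ Θ M} → (Γ ++ A₂ ∷ Θ) ⊩ M → (Γ ++ A₁ ∧ A₂ ∷ Θ) ⊩ M
  ∨L  : ∀ {Γ A₁ A₂ Θ} {M M₁ M₂ : Pred} →
        (Γ ++ A₁ ∷ Θ) ⊩ M₁ → (Γ ++ A₂ ∷ Θ) ⊩ M₂ →
        (∀ Ξ → M Ξ ⇔ (M₁ Ξ ⊎ M₂ Ξ)) → (Γ ++ A₁ ∨ A₂ ∷ Θ) ⊩ M
  ⋆L  : ∀ {Γ A Θ} {M : Pred} (Ms : ℕ → Pred) →
        (∀ n → (Γ ++ replicate n A ++ Θ) ⊩ Ms n) →
        (∀ Ξ → M Ξ ⇔ (∃[ n ] Ms n Ξ)) → (Γ ++ A ⋆ ∷ Θ) ⊩ M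

data Der : Sequent → Set₁ where
  ax    : ∀ {t} (A : Fm t) → Der (snoc [] A ⊢ A)
  ·L    : ∀ {t Γ A B} {Θ : Ante t} {E} →
          Der (prepend (Γ ++ A ∷ B ∷ []) Θ ⊢ E) → Der (prepend (Γ ++ A · B ∷ []) Θ ⊢ E)
  ⧵L    : ∀ {t Γ Π A B} {Θ : Ante t} {E} →
          Der (prepend (Γ ++ A ∷ []) Θ ⊢ E) → Der (⟪ Π ⟫ ⊢ B) →
          Der (prepend (Γ ++ Π ++ B ⧵ A ∷ []) Θ ⊢ E)
  /L    : ∀ {t Γ Ξ A D} {Θ : Ante t} {E} →
          Der (prepend (Γ ++ A ∷ []) Θ ⊢ E) → Der (⟪ Ξ ⟫ ⊢ D) →
          Der (prepend (Γ ++ A / D ∷ Ξ) Θ ⊢ E)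
  ∧L₁   : ∀ {t Γ A₁ A₂} {Θ : Ante t} {E} →
          Der (prepend (Γ ++ A₁ ∷ []) Θ ⊢ E) → Der (prepend (Γ ++ A₁ ∧ A₂ ∷ []) Θ ⊢ E)
  ∧L₂   : ∀ {t Γ A₁ A₂} {Θ : Ante t} {E} →
          Der (prepend (Γ ++ A₂ ∷ []) Θ ⊢ E) → Der (prepend (Γ ++ A₁ ∧ A₂ ∷ []) Θ ⊢ E)
  ∨L    : ∀ {t Γ A₁ A₂} {Θ : Ante t} {E} →
          Der (prepend (Γ ++ A₁ ∷ []) Θ ⊢ E) → Der (prepend (Γ ++ A₂ ∷ []) Θ ⊢ E) →
          Der (prepend (Γ ++ A₁ ∨ A₂ ∷ []) Θ ⊢ E)
  ⋆L    : ∀ {t Γ A} {Θ : Ante t} {E} →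
          (∀ n → Der (prepend (Γ ++ replicate n A) Θ ⊢ E)) →
          Der (prepend (Γ ++ A ⋆ ∷ []) Θ ⊢ E)
  /Lω   : ∀ {Γ A D} {Ξ : Ante omg} {E} →
          Der (⟪ Γ ∣ A ⟫ ⊢ E) → Der (Ξ ⊢ D) → Der (prepend (Γ ++ A / D ∷ []) Ξ ⊢ E)
  ·Lω   : ∀ {Γ A B E} → Der (⟪ Γ ++ A ∷ [] ∣ B ⟫ ⊢ E) → Der (⟪ Γ ∣ A · B ⟫ ⊢ E)
  ⧵Lω   : ∀ {Γ Π A B E} → Der (⟪ Γ ∣ A ⟫ ⊢ E) → Der (⟪ Π ⟫ ⊢ B) →
          Der (⟪ Γ ++ Π ∣ B ⧵ A ⟫ ⊢ E)
  ∧L₁ω  : ∀ {Γ A₁ A₂ E} → Der (⟪ Γ ∣ A₁ ⟫ ⊢ E) → Der (⟪ Γ ∣ A₁ ∧ A₂ ⟫ ⊢ E)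
  ∧L₂ω  : ∀ {Γ A₁ A₂ E} → Der (⟪ Γ ∣ A₂ ⟫ ⊢ E) → Der (⟪ Γ ∣ A₁ ∧ A₂ ⟫ ⊢ E)
  ∨Lω   : ∀ {Γ A₁ A₂ E} → Der (⟪ Γ ∣ A₁ ⟫ ⊢ E) → Der (⟪ Γ ∣ A₂ ⟫ ⊢ E) →
          Der (⟪ Γ ∣ A₁ ∨ A₂ ⟫ ⊢ E)
  ^ωL   : ∀ {Γ A E} → Der (⟪ Γ ++ˢ (λ _ → A) ⟫ω ⊢ E) → Der (⟪ Γ ∣ A ^ω ⟫ ⊢ E)
  Lω    : ∀ {C} (Δ : ℕ → List (Fm fin)) (M : ℕ → Pred) {f} →
          (∀ i → Δ i ⊩ M i) →
          (∀ (g : ℕ → List (Fm fin)) → (∀ i → M i (g i)) →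
             ∀ h → IsConcat g h → Der (⟪ h ⟫ω ⊢ C)) →
          IsConcat Δ f → Der (⟪ f ⟫ω ⊢ C)
  ^ωR   : ∀ {A} (Γ : ℕ → List (Fm fin)) {f} →
          (∀ i → Der (⟪ Γ i ⟫ ⊢ A)) → IsConcat Γ f → Der (⟪ f ⟫ω ⊢ A ^ω)
  /R    : ∀ {t Π} {A B : Fm t} → Der (snoc Π B ⊢ A) → Der (⟪ Π ⟫ ⊢ A / B)
  ⧵R    : ∀ {t B} {Θ : Ante t} {A} → Der (prepend (B ∷ []) Θ ⊢ A) → Der (Θ ⊢ B ⧵ A)
  ·R    : ∀ {t Γ A} {Θ : Ante t} {B} → Der (⟪ Γ ⟫ ⊢ A) → Der (Θ ⊢ B) →
          Der (prepend Γ Θ ⊢ A · B)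
  ∧R    : ∀ {t} {Θ : Ante t} {A₁ A₂} → Der (Θ ⊢ A₁) → Der (Θ ⊢ A₂) → Der (Θ ⊢ A₁ ∧ A₂)
  ∨R₁   : ∀ {t} {Θ : Ante t} {A₁ A₂} → Der (Θ ⊢ A₁) → Der (Θ ⊢ A₁ ∨ A₂)
  ∨R₂   : ∀ {t} {Θ : Ante t} {A₁ A₂} → Der (Θ ⊢ A₂) → Der (Θ ⊢ A₁ ∨ A₂)
  ⋆R    : ∀ {A} (n : ℕ) (Π : Fin n → List (Fm fin)) →
          (∀ i → Der (⟪ Π i ⟫ ⊢ A)) → Der (⟪ concat (tabulate Π) ⟫ ⊢ A ⋆)
  -- ω-sequences are functions ℕ → formulae; identify pointwise-equal ones
  -- (Agda has no function extensionality).
  ext   : ∀ {f g E} → Der (⟪ f ⟫ω ⊢ E) → (∀ n → f n ≡ g n) → Der (⟪ g ⟫ω ⊢ E)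

data RegExp : Set where
  rvar : ℕ → RegExp
  _·ʳ_ : RegExp → RegExp → RegExp
  _∨ʳ_ : RegExp → RegExp → RegExp
  _⋆ʳ  : RegExp → RegExp

data ωRegExp : Set where
  _·ʷ_ : RegExp → ωRegExp → ωRegExp
  _∨ʷ_ : ωRegExp → ωRegExp → ωRegExp
  _^ωʷ : RegExp → ωRegExp

⌜_⌝ : RegExp → Fm fin
⌜ rvar x ⌝ = var x
⌜ E ·ʳ F ⌝ = ⌜ E ⌝ · ⌜ F ⌝
⌜ E ∨ʳ F ⌝ = ⌜ E ⌝ ∨ ⌜ F ⌝
⌜ E ⋆ʳ ⌝ = ⌜ E ⌝ ⋆

⌜_⌝ω : ωRegExp → Fm omg
⌜ E ·ʷ R ⌝ω = ⌜ E ⌝ · ⌜ R ⌝ω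
⌜ R ∨ʷ S ⌝ω = ⌜ R ⌝ω ∨ ⌜ S ⌝ω
⌜ E ^ωʷ ⌝ω = ⌜ E ⌝ ^ω

Word : Set
Word = List ℕ

ωWord : Set
ωWord = Stream ℕ

Lang : RegExp → Word → Set
Lang (rvar x) w = w ≡ [ x ]
Lang (E ·ʳ F) w = ∃[ u ] ∃[ v ] (Lang E u × Lang F v × w ≡ u ++ v)
Lang (E ∨ʳ F) w = Lang E w ⊎ Lang F w
Lang (E ⋆ʳ) w = ∃[ us ] (All (Lang E) us × w ≡ concat us)

ωLang : ωRegExp → ωWord → Set
ωLang (E ·ʷ R) s = ∃[ u ] ∃[ t ] (Lang E u × ωLang R t × (∀ n → s n ≡ (u ++ˢ t) n))
ωLang (R ∨ʷ S) s = ωLang R s ⊎ ωLang S s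
ωLang (E ^ωʷ) s = ∃[ us ] ((∀ i → Lang E (us i) × us i ≢ []) × IsConcat us s)

{-# OPTIONS --safe #-}

-- Soundness holds in the language model: a finite formula denotes a set of words, an
-- ω-formula a set of ω-words, · is concatenation and ⧵, / are its residuals, and a variable
-- of Var_* denotes its one-letter word, so that ⌜ α ⌝ denotes L(α).  Every rule is locally
-- sound except ^ωR and Lω, which cut an ω-word into blocks along a decomposition of the
-- antecedent; these need a little theory of block decompositions of streams (regrouping,
-- flattening, discarding empty blocks).
-- Completeness runs the left rules ·L, ∨L, ⋆L (for ^ω: ^ωL followed by Lω) backwards: they
-- reduce α ⊢ β to the sequents w ⊢ β, one for each word w ∈ L(α) read as a sequence of
-- variables, and each of these has a derivation by right rules because w ∈ L(β).

module Submission where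

open import Defs
open import Data.Nat using (ℕ; zero; suc; _+_; _∸_; _<_; _≤_; _<?_; z≤n; s≤s; s≤s⁻¹; z<s)
open import Data.Nat.Properties
  using (+-identityʳ; +-suc; +-assoc; +-comm; ≤-refl; ≤-trans; <-≤-trans; ≤-<-trans; <⇒≤;
         m≤m+n; m≤n+m; m<m+n; m≤n⇒m<n∨m≡n; ≰⇒>; <⇒≱; ≮⇒≥; <⇒≢; <-irrefl; <-cmp; +-monoʳ-<; +-mono-≤;
         +-cancelˡ-<; +-cancelˡ-≡; m+[n∸m]≡n; suc-injective; module ≤-Reasoning)
open import Data.Fin using (Fin; toℕ; fromℕ<)
import Data.Fin as Fin
open import Data.Fin.Properties using (toℕ<n; fromℕ<-toℕ)
open import Data.List using (List; []; _∷_; _++_; [_]; length; lookup; concat; map; applyUpTo; replicate; tabulate)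
open import Data.List.Properties
  using (length-map; length-applyUpTo; length-++; ++-assoc; ++-identityʳ; map-++; map-tabulate;
         tabulate-lookup; concat-map)
open import Data.List.Membership.Propositional.Properties using (∈-lookup)
open import Data.List.Relation.Unary.All using (All; []; _∷_)
import Data.List.Relation.Unary.All as All
open import Data.List.Relation.Binary.Pointwise using (Pointwise; []; _∷_; Pointwise-length)
import Data.List.Relation.Binary.Pointwise as Pointwise
open import Data.Product using (∃-syntax; Σ-syntax; _×_; _,_; proj₁; proj₂)
open import Data.Sum using (_⊎_; inj₁; inj₂; [_,_]′)
open import Data.Unit using (⊤; tt)
open import Data.Empty using (⊥)
open import Function.Base using (_∘_; id; const)
open import Function.Bundles using (_⇔_; mk⇔; Equivalence)
open import Function.Properties.Equivalence using () renaming (sym to ⇔-sym; trans to ⇔-trans)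
open import Relation.Nullary using (yes; no; contradiction)
open import Relation.Binary.PropositionalEquality hiding ([_])
open import Relation.Binary.Definitions using (tri<; tri≈; tri>)

private variable
  X Y : Set
  t : Ty

dropˢ : ℕ → Stream X → Stream X
dropˢ k s n = s (k + n)

tailˢ : Stream X → Stream X
tailˢ = dropˢ 1

_∷ˢ_ : X → Stream X → Stream X
(x ∷ˢ s) zero    = x
(x ∷ˢ s) (suc n) = s n

++ˢ-cong : (w : List X) {s t : Stream X} → s ≗ t → w ++ˢ s ≗ w ++ˢ t
++ˢ-cong []      s≗t n       = s≗t n
++ˢ-cong (x ∷ w) s≗t zero    = refl
++ˢ-cong (x ∷ w) s≗t (suc n) = ++ˢ-cong w s≗t n

++ˢ-assoc : (w w′ : List X) (t : Stream X) → (w ++ w′) ++ˢ t ≗ w ++ˢ (w′ ++ˢ t)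
++ˢ-assoc []      w′ t n       = refl
++ˢ-assoc (x ∷ w) w′ t zero    = refl
++ˢ-assoc (x ∷ w) w′ t (suc n) = ++ˢ-assoc w w′ t n

dropˢ-++ˢ : (w : List X) (t : Stream X) → dropˢ (length w) (w ++ˢ t) ≗ t
dropˢ-++ˢ []      t n = refl
dropˢ-++ˢ (x ∷ w) t n = dropˢ-++ˢ w t n

map-++ˢ : (f : X → Y) (w : List X) (s : Stream X) → map f w ++ˢ (f ∘ s) ≗ f ∘ (w ++ˢ s)
map-++ˢ f []      s n       = refl
map-++ˢ f (x ∷ w) s zero    = refl
map-++ˢ f (x ∷ w) s (suc n) = map-++ˢ f w s n

Prefix : List X → Stream X → Set
Prefix []      s = ⊤
Prefix (x ∷ w) s = s 0 ≡ x × Prefix w (tailˢ s)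

Prefix-resp : (w : List X) {s t : Stream X} → s ≗ t → Prefix w s → Prefix w t
Prefix-resp []      s≗t _       = tt
Prefix-resp (x ∷ w) s≗t (p , q) = trans (sym (s≗t 0)) p , Prefix-resp w (s≗t ∘ suc) q

Prefix-++ˢ : (w : List X) (t : Stream X) → Prefix w (w ++ˢ t)
Prefix-++ˢ []      t = tt
Prefix-++ˢ (x ∷ w) t = refl , Prefix-++ˢ w t

Prefix⇒≗ : (w : List X) {s : Stream X} → Prefix w s → s ≗ w ++ˢ dropˢ (length w) s
Prefix⇒≗ []      _       n       = refl
Prefix⇒≗ (x ∷ w) (p , q) zero    = p
Prefix⇒≗ (x ∷ w) (p , q) (suc n) = Prefix⇒≗ w q n

Prefix⇒lookup : (w : List X) {s : Stream X} → Prefix w s → ∀ j → s (toℕ j) ≡ lookup w j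
Prefix⇒lookup (x ∷ w) (p , q) Fin.zero    = p
Prefix⇒lookup (x ∷ w) (p , q) (Fin.suc j) = Prefix⇒lookup w q j

lookup⇒Prefix : (w : List X) {s : Stream X} → (∀ j → s (toℕ j) ≡ lookup w j) → Prefix w s
lookup⇒Prefix []      eq = tt
lookup⇒Prefix (x ∷ w) eq = eq Fin.zero , lookup⇒Prefix w (eq ∘ Fin.suc)

Prefix-++⁺ : (w w′ : List X) {s : Stream X} →
             Prefix w s → Prefix w′ (dropˢ (length w) s) → Prefix (w ++ w′) s
Prefix-++⁺ []      w′ _       q = q
Prefix-++⁺ (x ∷ w) w′ (p , r) q = p , Prefix-++⁺ w w′ r q

Prefix-++⁻ : (w w′ : List X) {s : Stream X} →
             Prefix (w ++ w′) s → Prefix w s × Prefix w′ (dropˢ (length w) s)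
Prefix-++⁻ []      w′ q       = tt , q
Prefix-++⁻ (x ∷ w) w′ (p , q) = let r , r′ = Prefix-++⁻ w w′ q in (p , r) , r′

Prefix-map : (f : X → Y) (w : List X) {s : Stream X} → Prefix w s → Prefix (map f w) (f ∘ s)
Prefix-map f []      _       = tt
Prefix-map f (x ∷ w) (p , q) = cong f p , Prefix-map f w q

Prefix-applyUpTo : (f : Stream X) (m : ℕ) → Prefix (applyUpTo f m) f
Prefix-applyUpTo f zero    = tt
Prefix-applyUpTo f (suc m) = refl , Prefix-applyUpTo (f ∘ suc) m

Prefix-pointwise : {R : X → Y → Set} {w : List X} {w′ : List Y} {s : Stream X} {t : Stream Y} →
                   Pointwise R w w′ → Prefix w s → Prefix w′ t → ∀ m → m < length w → R (s m) (t m)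
Prefix-pointwise {R = R} (r ∷ _)  (p , _) (p′ , _) zero    _   = subst₂ R (sym p) (sym p′) r
Prefix-pointwise         (_ ∷ rs) (_ , q) (_ , q′) (suc m) m<n = Prefix-pointwise rs q q′ m (s≤s⁻¹ m<n)

Prefix-dropˢ-∷⁻ : (p : ℕ) {x : X} {w : List X} {s : Stream X} →
                  Prefix (x ∷ w) (dropˢ p s) → s p ≡ x × Prefix w (dropˢ (suc p) s)
Prefix-dropˢ-∷⁻ p {w = w} {s} (q , r) =
  trans (cong s (sym (+-identityʳ p))) q , Prefix-resp w (λ n → cong s (+-suc p n)) r

Prefix⇒Pointwise-applyUpTo : {R : X → Y → Set} (w : List X) {f : Stream X} {g : Stream Y} →
                             Prefix w f → (∀ n → R (f n) (g n)) → Pointwise R w (applyUpTo g (length w))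
Prefix⇒Pointwise-applyUpTo         []      _       r = []
Prefix⇒Pointwise-applyUpTo {R = R} (x ∷ w) (p , q) r =
  subst (λ y → R y _) p (r 0) ∷ Prefix⇒Pointwise-applyUpTo w q (r ∘ suc)

-- Block decompositions of streams

pos-cong : {u : Stream (List X)} {v : Stream (List Y)} →
           (∀ i → length (u i) ≡ length (v i)) → pos u ≗ pos v
pos-cong eq zero    = refl
pos-cong eq (suc i) = cong₂ _+_ (pos-cong eq i) (eq i)

pos-suc : (u : Stream (List X)) (i : ℕ) → pos u (suc i) ≡ length (u 0) + pos (tailˢ u) i
pos-suc u zero    = sym (+-identityʳ _)
pos-suc u (suc i) = trans (cong (_+ length (u (suc i))) (pos-suc u i)) (+-assoc (length (u 0)) _ _)

pos-mono-≤ : (u : Stream (List X)) {i j : ℕ} → i ≤ j → pos u i ≤ pos u j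
pos-mono-≤ u {j = zero}  z≤n = ≤-refl
pos-mono-≤ u {j = suc j} i≤1+j with m≤n⇒m<n∨m≡n i≤1+j
... | inj₁ i<1+j = ≤-trans (pos-mono-≤ u (s≤s⁻¹ i<1+j)) (m≤m+n _ _)
... | inj₂ refl  = ≤-refl

pos-<⇒< : (u : Stream (List X)) {i j : ℕ} → pos u i < pos u j → i < j
pos-<⇒< u lt = ≰⇒> (λ j≤i → <⇒≱ lt (pos-mono-≤ u j≤i))

pos+offset-< : (u : Stream (List X)) {k k′ m m′ : ℕ} →
               m < length (u k) → k < k′ → pos u k + m < pos u k′ + m′
pos+offset-< u {k} {k′} {m} {m′} m<len k<k′ = begin-strict
  pos u k + m    <⟨ +-monoʳ-< (pos u k) m<len ⟩
  pos u (suc k)  ≤⟨ pos-mono-≤ u k<k′ ⟩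
  pos u k′       ≤⟨ m≤m+n _ _ ⟩
  pos u k′ + m′  ∎
  where open ≤-Reasoning

Covering : Stream (List X) → Set
Covering u = ∀ n → ∃[ i ] (n < pos u i)

record IsConcat′ (u : Stream (List X)) (s : Stream X) : Set where
  constructor isConcat′
  field
    covering : Covering u
    prefixes : ∀ i → Prefix (u i) (dropˢ (pos u i) s)

open IsConcat′ public

module _ {u : Stream (List X)} {s : Stream X} where

  IsConcat⇒IsConcat′ : IsConcat u s → IsConcat′ u s
  IsConcat⇒IsConcat′ (c , eq) = isConcat′ c λ i → lookup⇒Prefix (u i) (eq i)

  IsConcat′⇒IsConcat : IsConcat′ u s → IsConcat u s
  IsConcat′⇒IsConcat (isConcat′ c p) = c , λ i → Prefix⇒lookup (u i) (p i)

Covering-cong : {u : Stream (List X)} {v : Stream (List Y)} →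
                (∀ i → length (u i) ≡ length (v i)) → Covering u → Covering v
Covering-cong eq c n = let i , n<pos = c n in i , subst (n <_) (pos-cong eq i) n<pos

IsConcat′-resp : {u : Stream (List X)} {s t : Stream X} → s ≗ t → IsConcat′ u s → IsConcat′ u t
IsConcat′-resp {u = u} s≗t (isConcat′ c p) =
  isConcat′ c λ i → Prefix-resp (u i) (λ n → s≗t (pos u i + n)) (p i)

IsConcat′-cong : {u v : Stream (List X)} {s : Stream X} → u ≗ v → IsConcat′ u s → IsConcat′ v s
IsConcat′-cong {s = s} u≗v (isConcat′ c p) = isConcat′
  (Covering-cong (cong length ∘ u≗v) c)
  λ i → subst₂ (λ w k → Prefix w (dropˢ k s)) (u≗v i) (pos-cong (cong length ∘ u≗v) i) (p i)

dropˢ-pos-suc : (u : Stream (List X)) (s : Stream Y) (i : ℕ) →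
                dropˢ (pos u (suc i)) s ≗ dropˢ (pos (tailˢ u) i) (dropˢ (length (u 0)) s)
dropˢ-pos-suc u s i n = cong s (trans (cong (_+ n) (pos-suc u i)) (+-assoc (length (u 0)) _ n))

IsConcat′-∷⁻ : {u : Stream (List X)} {s : Stream X} → IsConcat′ u s →
               s ≗ u 0 ++ˢ dropˢ (length (u 0)) s × IsConcat′ (tailˢ u) (dropˢ (length (u 0)) s)
IsConcat′-∷⁻ {u = u} {s} (isConcat′ c p) =
  Prefix⇒≗ (u 0) (p 0) , isConcat′ c′ λ i → Prefix-resp (u (suc i)) (dropˢ-pos-suc u s i) (p (suc i))
  where
  c′ : Covering (tailˢ u)
  c′ n with c (length (u 0) + n)
  ... | suc i , lt = i , +-cancelˡ-< (length (u 0)) _ _ (subst (length (u 0) + n <_) (pos-suc u i) lt)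

IsConcat′-∷⁺ : {w : List X} {u : Stream (List X)} {s t : Stream X} →
               s ≗ w ++ˢ t → IsConcat′ u t → IsConcat′ (w ∷ˢ u) s
IsConcat′-∷⁺ {w = w} {u} {s} {t} s≗wt (isConcat′ c p) = isConcat′ c′ p′
  where
  c′ : Covering (w ∷ˢ u)
  c′ n = let i , lt = c n in suc i , subst (n <_) (sym (pos-suc (w ∷ˢ u) i)) (≤-trans lt (m≤n+m _ _))
  p′ : ∀ i → Prefix ((w ∷ˢ u) i) (dropˢ (pos (w ∷ˢ u) i) s)
  p′ zero    = Prefix-resp w (sym ∘ s≗wt) (Prefix-++ˢ w t)
  p′ (suc i) = Prefix-resp (u i) (λ n → sym (begin
    s (pos (w ∷ˢ u) (suc i) + n)          ≡⟨ dropˢ-pos-suc (w ∷ˢ u) s i n ⟩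
    s (length w + (pos u i + n))          ≡⟨ s≗wt _ ⟩
    (w ++ˢ t) (length w + (pos u i + n))  ≡⟨ dropˢ-++ˢ w t _ ⟩
    t (pos u i + n)                       ∎)) (p i)
    where open ≡-Reasoning

IsConcat′-singletons : (s : Stream X) → IsConcat′ ([_] ∘ s) s
IsConcat′-singletons s = isConcat′ (λ n → suc n , subst (n <_) (sym (pos-singletons (suc n))) ≤-refl)
                         λ i → cong s (trans (+-identityʳ _) (pos-singletons i)) , tt
  where
  pos-singletons : ∀ i → pos ([_] ∘ s) i ≡ i
  pos-singletons zero    = refl
  pos-singletons (suc i) = trans (cong (_+ 1) (pos-singletons i)) (+-comm i 1)

IsConcat′-map : (f : X → Y) {u : Stream (List X)} {s : Stream X} →
                IsConcat′ u s → IsConcat′ (map f ∘ u) (f ∘ s)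
IsConcat′-map f {u} {s} (isConcat′ c p) = isConcat′
  (Covering-cong (sym ∘ length-map f ∘ u) c)
  λ i → subst (λ k → Prefix (map f (u i)) (dropˢ k (f ∘ s))) (pos-cong (sym ∘ length-map f ∘ u) i)
              (Prefix-map f (u i) (p i))

Location : Stream (List X) → ℕ → Set
Location u n = ∃[ k ] ∃[ m ] (m < length (u k) × n ≡ pos u k + m)

locate : {u : Stream (List X)} → Covering u → ∀ n → Location u n
locate {u = u} c n = below (proj₁ (c n)) (proj₂ (c n))
  where
  below : ∀ k → n < pos u k → Location u n
  below (suc k) n<pos with n <? pos u k
  ... | yes n<pos′ = below k n<pos′
  ... | no  n≮pos′ = k , n ∸ pos u k ,
        +-cancelˡ-< (pos u k) _ _ (subst (_< pos u (suc k)) n≡ n<pos) , n≡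
    where n≡ = sym (m+[n∸m]≡n (≮⇒≥ n≮pos′))

Location-unique : (u : Stream (List X)) {k k′ m m′ : ℕ} → m < length (u k) → m′ < length (u k′) →
                  pos u k + m ≡ pos u k′ + m′ → k ≡ k′ × m ≡ m′
Location-unique u {k} {k′} m<len m′<len eq with <-cmp k k′
... | tri< k<k′ _ _ = contradiction eq (<⇒≢ (pos+offset-< u m<len k<k′))
... | tri≈ _ refl _ = refl , +-cancelˡ-≡ (pos u k) _ _ eq
... | tri> _ _ k′<k = contradiction (sym eq) (<⇒≢ (pos+offset-< u m′<len k′<k))

flatten : (u : Stream (List X)) → Covering u → Stream X
flatten u c n = let k , m , m<len , _ = locate c n in lookup (u k) (fromℕ< m<len)

flatten-pos : {u : Stream (List X)} (c : Covering u) (k m : ℕ) (m<len : m < length (u k)) →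
              flatten u c (pos u k + m) ≡ lookup (u k) (fromℕ< m<len)
flatten-pos {u = u} c k m m<len with locate c (pos u k + m)
... | k′ , m′ , m′<len , eq with Location-unique u m<len m′<len eq
... | refl , refl = refl

IsConcat′-flatten : {u : Stream (List X)} (c : Covering u) → IsConcat′ u (flatten u c)
IsConcat′-flatten {u = u} c = isConcat′ c λ k → lookup⇒Prefix (u k) λ j →
  trans (flatten-pos c k (toℕ j) (toℕ<n j)) (cong (lookup (u k)) (fromℕ<-toℕ j _))

IsConcat′-pointwise : {R : X → Y → Set} {u : Stream (List X)} {v : Stream (List Y)}
                      {s : Stream X} {t : Stream Y} → IsConcat′ u s → IsConcat′ v t →
                      (∀ k → Pointwise R (u k) (v k)) → ∀ n → R (s n) (t n)
IsConcat′-pointwise {u = u} {v} {t = t} (isConcat′ c p) (isConcat′ _ q) uRv n with locate c n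
... | k , m , m<len , refl =
  Prefix-pointwise (uRv k) (p k)
    (subst (λ i → Prefix (v k) (dropˢ i t)) (sym (pos-cong (Pointwise-length ∘ uRv) k)) (q k)) m m<len

IsConcat′-unique : {u : Stream (List X)} {s t : Stream X} → IsConcat′ u s → IsConcat′ u t → s ≗ t
IsConcat′-unique us ut = IsConcat′-pointwise {R = _≡_} us ut (λ k → Pointwise.refl refl)

IsConcat′-map⁻ : (f : X → Y) {u : Stream (List X)} {t : Stream Y} →
                 IsConcat′ (map f ∘ u) t → ∃[ s ] (IsConcat′ u s × t ≗ f ∘ s)
IsConcat′-map⁻ f {u} fut@(isConcat′ c _) =
  flatten u c′ , IsConcat′-flatten c′ , IsConcat′-unique fut (IsConcat′-map f (IsConcat′-flatten c′))
  where c′ = Covering-cong (length-map f ∘ u) c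

module _ (P : Stream (List (List X))) (u : Stream (List X)) (Pu : IsConcat′ P u) where

  private
    BlockAt : Stream X → ℕ → Set
    BlockAt s i = Prefix (u i) (dropˢ (pos u i) s)

  pos-length-concat : ∀ L p → Prefix L (dropˢ p u) → pos u (p + length L) ≡ pos u p + length (concat L)
  pos-length-concat []      p _ = trans (cong (pos u) (+-identityʳ p)) (sym (+-identityʳ _))
  pos-length-concat (l ∷ L) p h with Prefix-dropˢ-∷⁻ p {s = u} h
  ... | refl , h′ = begin
    pos u (p + suc (length L))                ≡⟨ cong (pos u) (+-suc p _) ⟩
    pos u (suc p + length L)                  ≡⟨ pos-length-concat L (suc p) h′ ⟩
    pos u p + length (u p) + length (concat L)  ≡⟨ +-assoc (pos u p) _ _ ⟩
    pos u p + (length (u p) + length (concat L)) ≡⟨ cong (pos u p +_) (sym (length-++ (u p))) ⟩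
    pos u p + length (u p ++ concat L)        ∎
    where open ≡-Reasoning

  pos-concat : ∀ k → pos (concat ∘ P) k ≡ pos u (pos P k)
  pos-concat zero    = refl
  pos-concat (suc k) = trans (cong (_+ length (concat (P k))) (pos-concat k))
                             (sym (pos-length-concat (P k) (pos P k) (prefixes Pu k)))

  Prefix-concat⁺ : {s : Stream X} → (∀ i → BlockAt s i) →
                   ∀ L p → Prefix L (dropˢ p u) → Prefix (concat L) (dropˢ (pos u p) s)
  Prefix-concat⁺         us []      p _ = tt
  Prefix-concat⁺ {s = s} us (l ∷ L) p h with Prefix-dropˢ-∷⁻ p {s = u} h
  ... | refl , h′ = Prefix-++⁺ (u p) (concat L) (us p)
    (Prefix-resp (concat L) (λ n → cong s (+-assoc (pos u p) _ n)) (Prefix-concat⁺ {s = s} us L (suc p) h′))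

  Prefix-concat⁻ : {s : Stream X} → ∀ L p → Prefix L (dropˢ p u) → Prefix (concat L) (dropˢ (pos u p) s) →
                   ∀ m → m < length L → BlockAt s (p + m)
  Prefix-concat⁻ {s = s} (l ∷ L) p h hs m m<len with Prefix-dropˢ-∷⁻ p {s = u} h
  ... | refl , h′ with Prefix-++⁻ (u p) (concat L) hs | m
  ...   | hp , _   | zero  = subst (BlockAt s) (sym (+-identityʳ p)) hp
  ...   | _  , hL  | suc m = subst (BlockAt s) (sym (+-suc p m))
    (Prefix-concat⁻ {s = s} L (suc p) h′ (Prefix-resp (concat L) (λ n → cong s (sym (+-assoc (pos u p) _ n))) hL)
                    m (s≤s⁻¹ m<len))

  IsConcat′-concat⁺ : {s : Stream X} → IsConcat′ u s → IsConcat′ (concat ∘ P) s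
  IsConcat′-concat⁺ {s} (isConcat′ c us) = isConcat′ c′ λ k →
    subst (λ i → Prefix (concat (P k)) (dropˢ i s)) (sym (pos-concat k))
          (Prefix-concat⁺ {s = s} us (P k) (pos P k) (prefixes Pu k))
    where
    c′ : Covering (concat ∘ P)
    c′ n = let i , n<i = c n ; k , i<k = covering Pu i in
      k , subst (n <_) (sym (pos-concat k)) (<-≤-trans n<i (pos-mono-≤ u (<⇒≤ i<k)))

  IsConcat′-concat⁻ : {s : Stream X} → IsConcat′ (concat ∘ P) s → IsConcat′ u s
  IsConcat′-concat⁻ {s} (isConcat′ c cs) = isConcat′ c′ us
    where
    c′ : Covering u
    c′ n = let k , n<k = c n in pos P k , subst (n <_) (pos-concat k) n<k
    us : ∀ i → BlockAt s i
    us i with locate (covering Pu) i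
    ... | k , m , m<len , refl = Prefix-concat⁻ {s = s} (P k) (pos P k) (prefixes Pu k)
      (subst (λ i → Prefix (concat (P k)) (dropˢ i s)) (pos-concat k) (cs k)) m m<len

group : Stream (List Y) → Stream X → Stream (List X)
group Δ u k = applyUpTo (dropˢ (pos Δ k) u) (length (Δ k))

IsConcat′-group : {Δ : Stream (List Y)} {u : Stream X} → Covering Δ → IsConcat′ (group Δ u) u
IsConcat′-group {Δ = Δ} {u} c = isConcat′
  (Covering-cong (sym ∘ length-group) c)
  λ k → subst (λ i → Prefix (group Δ u k) (dropˢ i u)) (pos-cong (sym ∘ length-group) k)
              (Prefix-applyUpTo (dropˢ (pos Δ k) u) (length (Δ k)))
  where
  length-group : ∀ k → length (group Δ u k) ≡ length (Δ k)
  length-group k = length-applyUpTo _ _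

group-pointwise : {R : Y → X → Set} {Δ : Stream (List Y)} {f : Stream Y} {u : Stream X} →
                  IsConcat′ Δ f → (∀ n → R (f n) (u n)) → ∀ k → Pointwise R (Δ k) (group Δ u k)
group-pointwise {Δ = Δ} (isConcat′ _ p) fRu k =
  Prefix⇒Pointwise-applyUpTo (Δ k) (p k) (λ n → fRu (pos Δ k + n))

module _ {u : Stream (List X)} {v : Stream (List Y)} (empty⇒empty : ∀ k → u k ≡ [] → v k ≡ []) where

  pos-<-transfer : ∀ i j → pos v i < pos v j → pos u i < pos u j
  pos-<-transfer i (suc j) lt with pos v i <? pos v j
  ... | yes lt′ = <-≤-trans (pos-<-transfer i j lt′) (m≤m+n _ _)
  ... | no  nlt with u j in eq
  ...   | x ∷ xs = ≤-<-trans (pos-mono-≤ u (s≤s⁻¹ (pos-<⇒< v {i} {suc j} lt))) (m<m+n (pos u j) z<s)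
  ...   | []     = contradiction (subst (λ w → pos v i < pos v j + length w) (empty⇒empty j eq) lt)
                                 (nlt ∘ subst (pos v i <_) (+-identityʳ _))

  Covering-transfer : Covering v → Covering u
  Covering-transfer c zero    = let j , lt = c 0 in j , pos-<-transfer 0 j lt
  Covering-transfer c (suc n) = let i , n<i = Covering-transfer c n ; j , lt = c (pos v i) in
                                j , ≤-<-trans n<i (pos-<-transfer i j lt)

concat-applyUpTo-empties : (f : Stream (List X)) (e : ℕ) → (∀ j → j < e → f j ≡ []) →
                           concat (applyUpTo f (suc e)) ≡ f e
concat-applyUpTo-empties f zero    _     = ++-identityʳ (f 0)
concat-applyUpTo-empties f (suc e) empty =
  trans (cong (_++ concat (applyUpTo (f ∘ suc) (suc e))) (empty 0 z<s))
        (concat-applyUpTo-empties (f ∘ suc) e (λ j → empty (suc j) ∘ s≤s))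

module _ {u : Stream (List X)} (c : Covering u) where

  private
    NextNonEmpty : ℕ → ℕ → Set
    NextNonEmpty b e = (∀ j → j < e → u (b + j) ≡ []) × u (b + e) ≢ []

  nonEmpty-within : ∀ b d → pos u b < pos u (b + d) → ∃[ e ] NextNonEmpty b e
  nonEmpty-within b zero lt = contradiction lt (<-irrefl (cong (pos u) (sym (+-identityʳ b))))
  nonEmpty-within b (suc d) lt with u b in eq
  ... | x ∷ xs = 0 , (λ _ ()) , λ e → contradiction (trans (sym (trans (cong u (+-identityʳ b)) eq)) e) λ ()
  ... | []     =
    let e , empties , ne = nonEmpty-within (suc b) d (subst₂ _<_ pos-b (cong (pos u) (+-suc b d)) lt) in
    suc e ,
    (λ { zero    _   → trans (cong u (+-identityʳ b)) eq
       ; (suc j) j<e → trans (cong u (+-suc b j)) (empties j (s≤s⁻¹ j<e)) }) ,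
    subst (λ i → u i ≢ []) (sym (+-suc b e)) ne
    where
    pos-b : pos u b ≡ pos u (suc b)
    pos-b = sym (trans (cong (λ w → pos u b + length w) eq) (+-identityʳ _))

  nextNonEmpty : ∀ b → ∃[ e ] NextNonEmpty b e
  nextNonEmpty b = let j , lt = c (pos u b) ; b≤j = <⇒≤ (pos-<⇒< u {b} {j} lt) in
    nonEmpty-within b (j ∸ b) (subst (λ i → pos u b < pos u i) (sym (m+[n∸m]≡n b≤j)) lt)

  -- The k-th run consists of the empty blocks before the k-th nonempty block, then that block.
  private
    skip : ℕ → ℕ
    skip b = proj₁ (nextNonEmpty b)

    start : ℕ → ℕ
    start zero    = 0
    start (suc k) = start k + suc (skip (start k))

    runs : Stream (List (List X))
    runs k = applyUpTo (dropˢ (start k) u) (suc (skip (start k)))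

    pos-runs : pos runs ≗ start
    pos-runs zero    = refl
    pos-runs (suc k) = cong₂ _+_ (pos-runs k) (length-applyUpTo (dropˢ (start k) u) _)

    start-≥ : ∀ k → k ≤ start k
    start-≥ zero    = z≤n
    start-≥ (suc k) = subst (_≤ start (suc k)) (+-comm k 1) (+-mono-≤ (start-≥ k) (s≤s z≤n))

    runs-u : IsConcat′ runs u
    runs-u = isConcat′ (λ n → suc n , subst (n <_) (sym (pos-runs (suc n))) (start-≥ (suc n)))
             λ k → subst (λ i → Prefix (runs k) (dropˢ i u)) (sym (pos-runs k))
                         (Prefix-applyUpTo (dropˢ (start k) u) _)

  removeEmpty : (P : List X → Set) → (∀ i → P (u i)) → {s : Stream X} → IsConcat′ u s →
                ∃[ v ] ((∀ k → P (v k) × v k ≢ []) × IsConcat′ v s)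
  removeEmpty P Pu us =
    (λ k → u (start k + skip (start k))) ,
    (λ k → Pu _ , proj₂ (proj₂ (nextNonEmpty (start k)))) ,
    IsConcat′-cong (λ k → concat-applyUpTo-empties (dropˢ (start k) u) _ (proj₁ (proj₂ (nextNonEmpty (start k)))))
                   (IsConcat′-concat⁺ runs u runs-u us)

ωLang-^ω : ∀ {E us s} → (∀ i → Lang E (us i)) → IsConcat′ us s → ωLang (E ^ωʷ) s
ωLang-^ω {E} pus us-s =
  let vs , pvs , vs-s = removeEmpty (covering us-s) (Lang E) pus us-s in vs , pvs , IsConcat′⇒IsConcat vs-s

-- The language model

Obj : Ty → Set
Obj fin = Word
Obj omg = ωWord

Eq : ∀ t → Obj t → Obj t → Set
Eq fin = _≡_
Eq omg = _≗_

append : ∀ t → Word → Obj t → Obj t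
append fin = _++_
append omg = _++ˢ_

Eq-refl : ∀ t {x : Obj t} → Eq t x x
Eq-refl fin   = refl
Eq-refl omg _ = refl

Eq-sym : ∀ t {x y : Obj t} → Eq t x y → Eq t y x
Eq-sym fin eq = sym eq
Eq-sym omg eq = sym ∘ eq

Eq-trans : ∀ t {x y z : Obj t} → Eq t x y → Eq t y z → Eq t x z
Eq-trans fin eq eq′ = trans eq eq′
Eq-trans omg eq eq′ n = trans (eq n) (eq′ n)

append-[] : ∀ t (x : Obj t) → Eq t (append t [] x) x
append-[] fin x   = refl
append-[] omg x _ = refl

append-cong : ∀ t (w : Word) {x y : Obj t} → Eq t x y → Eq t (append t w x) (append t w y)
append-cong fin w eq = cong (w ++_) eq
append-cong omg w eq = ++ˢ-cong w eq

append-assoc : ∀ t (w w′ : Word) (x : Obj t) → Eq t (append t (w ++ w′) x) (append t w (append t w′ x))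
append-assoc fin = ++-assoc
append-assoc omg = ++ˢ-assoc

Closed : (Obj t → Set) → Set
Closed {t} Q = ∀ {x y} → Eq t x y → Q x → Q y

infixr 5 _⊗_

record _⊗_ (P : Word → Set) (Q : Obj t → Set) (x : Obj t) : Set where
  constructor split
  field
    {left}  : Word
    {right} : Obj t
    left∈   : P left
    right∈  : Q right
    joined  : Eq t x (append t left right)

record ⨂ (L : ℕ → Word → Set) (s : ωWord) : Set where
  constructor blocks
  field
    {words}  : Stream Word
    words∈   : ∀ n → L n (words n)
    words-s  : IsConcat′ words s

open ⨂ public

⊗-map : {P P′ : Word → Set} {Q Q′ : Obj t → Set} →
        (∀ {w} → P w → P′ w) → (∀ {y} → Q y → Q′ y) → ∀ {x} → (P ⊗ Q) x → (P′ ⊗ Q′) x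
⊗-map f g (split p q eq) = split (f p) (g q) eq

⊗-closed : {P : Word → Set} {Q : Obj t → Set} → Closed (P ⊗ Q)
⊗-closed {t} x≈y (split p q eq) = split p q (Eq-trans t (Eq-sym t x≈y) eq)

⨂-closed : {L : ℕ → Word → Set} → Closed (⨂ L)
⨂-closed s≗t (blocks pus us-s) = blocks pus (IsConcat′-resp s≗t us-s)

module _ {P Q : Word → Set} {R : Obj t → Set} where

  ⊗-assoc⁺ : ∀ {x} → ((P ⊗ Q) ⊗ R) x → (P ⊗ Q ⊗ R) x
  ⊗-assoc⁺ (split {right = y} (split {w} {w′} p q refl) r eq) =
    split p (split q r (Eq-refl t)) (Eq-trans t eq (append-assoc t w w′ y))

  ⊗-assoc⁻ : ∀ {x} → (P ⊗ Q ⊗ R) x → ((P ⊗ Q) ⊗ R) x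
  ⊗-assoc⁻ (split {w} p (split {w′} {y′} q r eq′) eq) =
    split (split p q refl) r
          (Eq-trans t eq (Eq-trans t (append-cong t w eq′) (Eq-sym t (append-assoc t w w′ y′))))

ε : Word → Set
ε = _≡ []

ε⊗-elim : {Q : Obj t → Set} → Closed Q → ∀ {x} → (ε ⊗ Q) x → Q x
ε⊗-elim {t} closed (split {right = y} refl q eq) = closed (Eq-sym t (Eq-trans t eq (append-[] t y))) q

ε⊗-intro : {Q : Obj t → Set} → ∀ {x} → Q x → (ε ⊗ Q) x
ε⊗-intro {t} {x = x} q = split refl q (Eq-sym t (append-[] t x))

⊗ε-elim : {P : Word → Set} → ∀ {w} → (P ⊗ ε) w → P w
⊗ε-elim {P} (split {w} p refl refl) = subst P (sym (++-identityʳ w)) p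

⊗ε-intro : {P : Word → Set} → ∀ {w} → P w → (P ⊗ ε) w
⊗ε-intro {w = w} p = split p refl (sym (++-identityʳ w))

⟦_⟧ : Fm t → Obj t → Set
⟦ var x ⟧           w = w ≡ [ x ]
⟦ ovar x ⟧          _ = ⊥
⟦ A · B ⟧             = ⟦ A ⟧ ⊗ ⟦ B ⟧
⟦ _⧵_ {t} A B ⟧     x = ∀ w → ⟦ A ⟧ w → ⟦ B ⟧ (append t w x)
⟦ _/_ {t} A B ⟧     w = ∀ y → ⟦ B ⟧ y → ⟦ A ⟧ (append t w y)
⟦ A ∨ B ⟧           x = ⟦ A ⟧ x ⊎ ⟦ B ⟧ x
⟦ A ∧ B ⟧           x = ⟦ A ⟧ x × ⟦ B ⟧ x
⟦ A ⋆ ⟧             w = ∃[ ws ] (All ⟦ A ⟧ ws × w ≡ concat ws)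
⟦ A ^ω ⟧              = ⨂ (λ _ → ⟦ A ⟧)

⟦_⟧* : List (Fm fin) → Word → Set
⟦ [] ⟧*    = ε
⟦ A ∷ Γ ⟧* = ⟦ A ⟧ ⊗ ⟦ Γ ⟧*

⟦_⟧ᴬ : Ante t → Obj t → Set
⟦ ⟪ Γ ⟫ ⟧ᴬ     = ⟦ Γ ⟧*
⟦ ⟪ f ⟫ω ⟧ᴬ    = ⨂ (⟦_⟧ ∘ f)
⟦ ⟪ Γ ∣ C ⟫ ⟧ᴬ = ⟦ Γ ⟧* ⊗ ⟦ C ⟧

⟦⟧-closed : (A : Fm t) → Closed ⟦ A ⟧
⟦⟧-closed {fin} A       refl a        = a
⟦⟧-closed {omg} (ovar x) _    ()
⟦⟧-closed {omg} (A · B)               = ⊗-closed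
⟦⟧-closed {omg} (A ⧵ B) s≗t  f w a    = ⟦⟧-closed B (++ˢ-cong w s≗t) (f w a)
⟦⟧-closed {omg} (A ∨ B) s≗t  (inj₁ a) = inj₁ (⟦⟧-closed A s≗t a)
⟦⟧-closed {omg} (A ∨ B) s≗t  (inj₂ b) = inj₂ (⟦⟧-closed B s≗t b)
⟦⟧-closed {omg} (A ∧ B) s≗t  (a , b)  = ⟦⟧-closed A s≗t a , ⟦⟧-closed B s≗t b
⟦⟧-closed {omg} (A ^ω)                = ⨂-closed

⟦++⟧*⁻ : ∀ Γ Δ {w} → ⟦ Γ ++ Δ ⟧* w → (⟦ Γ ⟧* ⊗ ⟦ Δ ⟧*) w
⟦++⟧*⁻ []      Δ p = ε⊗-intro p
⟦++⟧*⁻ (A ∷ Γ) Δ p = ⊗-assoc⁻ (⊗-map id (⟦++⟧*⁻ Γ Δ) p)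

⟦++⟧*⁺ : ∀ Γ Δ {w} → (⟦ Γ ⟧* ⊗ ⟦ Δ ⟧*) w → ⟦ Γ ++ Δ ⟧* w
⟦++⟧*⁺ []      Δ p = ε⊗-elim (λ { refl d → d }) p
⟦++⟧*⁺ (A ∷ Γ) Δ p = ⊗-map id (⟦++⟧*⁺ Γ Δ) (⊗-assoc⁺ p)

⟦prepend⟧⁻ : ∀ Γ (Θ : Ante t) {x} → ⟦ prepend Γ Θ ⟧ᴬ x → (⟦ Γ ⟧* ⊗ ⟦ Θ ⟧ᴬ) x
⟦prepend⟧⁻ Γ       ⟪ Δ ⟫     p = ⟦++⟧*⁻ Γ Δ p
⟦prepend⟧⁻ Γ       ⟪ Δ ∣ C ⟫ p = ⊗-assoc⁺ (⊗-map (⟦++⟧*⁻ Γ Δ) id p)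
⟦prepend⟧⁻ []      ⟪ f ⟫ω    p = ε⊗-intro p
⟦prepend⟧⁻ (A ∷ Γ) ⟪ f ⟫ω    (blocks {us} pus us-x) =
  let x≗ , tail-x = IsConcat′-∷⁻ us-x in
  ⊗-assoc⁻ (split (pus 0) (⟦prepend⟧⁻ Γ ⟪ f ⟫ω (blocks (pus ∘ suc) tail-x)) x≗)

⟦prepend⟧⁺ : ∀ Γ (Θ : Ante t) {x} → (⟦ Γ ⟧* ⊗ ⟦ Θ ⟧ᴬ) x → ⟦ prepend Γ Θ ⟧ᴬ x
⟦prepend⟧⁺ Γ       ⟪ Δ ⟫     p = ⟦++⟧*⁺ Γ Δ p
⟦prepend⟧⁺ Γ       ⟪ Δ ∣ C ⟫ p = ⊗-map (⟦++⟧*⁺ Γ Δ) id (⊗-assoc⁻ p)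
⟦prepend⟧⁺ []      ⟪ f ⟫ω    p = ε⊗-elim ⨂-closed p
⟦prepend⟧⁺ (A ∷ Γ) ⟪ f ⟫ω    p with ⊗-assoc⁺ p
... | split {w} a rest x≗ =
  let blocks pus us-y = ⟦prepend⟧⁺ Γ ⟪ f ⟫ω rest in
  blocks (λ { zero → a ; (suc n) → pus n }) (IsConcat′-∷⁺ {w = w} x≗ us-y)

⟦prepend-++⟧⁻ : ∀ Γ Δ (Θ : Ante t) {x} →
                ⟦ prepend (Γ ++ Δ) Θ ⟧ᴬ x → (⟦ Γ ⟧* ⊗ ⟦ Δ ⟧* ⊗ ⟦ Θ ⟧ᴬ) x
⟦prepend-++⟧⁻ Γ Δ Θ p = ⊗-assoc⁺ (⊗-map (⟦++⟧*⁻ Γ Δ) id (⟦prepend⟧⁻ (Γ ++ Δ) Θ p))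

⟦prepend-++⟧⁺ : ∀ Γ Δ (Θ : Ante t) {x} →
                (⟦ Γ ⟧* ⊗ ⟦ Δ ⟧* ⊗ ⟦ Θ ⟧ᴬ) x → ⟦ prepend (Γ ++ Δ) Θ ⟧ᴬ x
⟦prepend-++⟧⁺ Γ Δ Θ p = ⟦prepend⟧⁺ (Γ ++ Δ) Θ (⊗-map (⟦++⟧*⁺ Γ Δ) id (⊗-assoc⁻ p))

focus : ∀ Γ Δ (Θ : Ante t) {x} → ⟦ prepend (Γ ++ Δ) Θ ⟧ᴬ x →
        ∃[ m ] (⟦ Δ ⟧* m × (∀ {Δ′} → ⟦ Δ′ ⟧* m → ⟦ prepend (Γ ++ Δ′) Θ ⟧ᴬ x))
focus Γ Δ Θ p with ⟦prepend-++⟧⁻ Γ Δ Θ p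
... | split pw (split {m} pm py v≡) x≈ =
  m , pm , λ {Δ′} pm′ → ⟦prepend-++⟧⁺ Γ Δ′ Θ (split pw (split pm′ py v≡) x≈)

focus* : ∀ Γ Δ Θ {w} → ⟦ Γ ++ Δ ++ Θ ⟧* w →
         ∃[ m ] (⟦ Δ ⟧* m × (∀ {Δ′} → ⟦ Δ′ ⟧* m → ⟦ Γ ++ Δ′ ++ Θ ⟧* w))
focus* Γ Δ Θ p with ⊗-map id (⟦++⟧*⁻ Δ Θ) (⟦++⟧*⁻ Γ (Δ ++ Θ) p)
... | split pw (split {m} pm py v≡) w≡ =
  m , pm , λ {Δ′} pm′ → ⟦++⟧*⁺ Γ (Δ′ ++ Θ) (split pw (⟦++⟧*⁺ Δ′ Θ (split pm′ py v≡)) w≡)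

replace : ∀ Γ {Δ Δ′} (Θ : Ante t) → (∀ {m} → ⟦ Δ ⟧* m → ⟦ Δ′ ⟧* m) →
          ∀ {x} → ⟦ prepend (Γ ++ Δ) Θ ⟧ᴬ x → ⟦ prepend (Γ ++ Δ′) Θ ⟧ᴬ x
replace Γ {Δ} Θ f p = let _ , pm , back = focus Γ Δ Θ p in back (f pm)

replace* : ∀ Γ {Δ Δ′} Θ → (∀ {m} → ⟦ Δ ⟧* m → ⟦ Δ′ ⟧* m) →
           ∀ {w} → ⟦ Γ ++ Δ ++ Θ ⟧* w → ⟦ Γ ++ Δ′ ++ Θ ⟧* w
replace* Γ {Δ} Θ f p = let _ , pm , back = focus* Γ Δ Θ p in back (f pm)

⟦⟧*⇒Pointwise : ∀ Γ {w} → ⟦ Γ ⟧* w → ∃[ ws ] (Pointwise (λ A → ⟦ A ⟧) Γ ws × w ≡ concat ws)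
⟦⟧*⇒Pointwise []      refl                  = [] , [] , refl
⟦⟧*⇒Pointwise (A ∷ Γ) (split {w} a pv refl) =
  let ws , pws , v≡ = ⟦⟧*⇒Pointwise Γ pv in w ∷ ws , a ∷ pws , cong (w ++_) v≡

Pointwise⇒⟦⟧* : ∀ {Γ ws} → Pointwise (λ A → ⟦ A ⟧) Γ ws → ⟦ Γ ⟧* (concat ws)
Pointwise⇒⟦⟧* []        = refl
Pointwise⇒⟦⟧* (a ∷ pws) = split a (Pointwise⇒⟦⟧* pws) refl

⨂-group : ∀ {Δ f x} → IsConcat′ Δ f → ⟦ ⟪ f ⟫ω ⟧ᴬ x → ⨂ (⟦_⟧* ∘ Δ) x
⨂-group {Δ} Δf (blocks {us} pus us-x) =
  blocks (λ k → Pointwise⇒⟦⟧* (group-pointwise Δf pus k))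
         (IsConcat′-concat⁺ (group Δ us) us (IsConcat′-group (covering Δf)) us-x)

⨂-ungroup : ∀ {Δ f x} → IsConcat′ Δ f → ⨂ (⟦_⟧* ∘ Δ) x → ⟦ ⟪ f ⟫ω ⟧ᴬ x
⨂-ungroup {Δ} Δf (blocks {vs} pvs vs-x) =
  blocks (IsConcat′-pointwise Δf (IsConcat′-flatten cP) (proj₁ ∘ proj₂ ∘ factor))
         (IsConcat′-concat⁻ P (flatten P cP) (IsConcat′-flatten cP)
                            (IsConcat′-cong (proj₂ ∘ proj₂ ∘ factor) vs-x))
  where
  factor : ∀ k → ∃[ ws ] (Pointwise (λ A → ⟦ A ⟧) (Δ k) ws × vs k ≡ concat ws)
  factor k = ⟦⟧*⇒Pointwise (Δ k) (pvs k)
  P : Stream (List Word)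
  P = proj₁ ∘ factor
  cP : Covering P
  cP = Covering-cong (Pointwise-length ∘ proj₁ ∘ proj₂ ∘ factor) (covering Δf)

Lang⇒⟦⟧ : ∀ α {w} → Lang α w → ⟦ ⌜ α ⌝ ⟧ w
Lang⇒⟦⟧ (rvar x) p                     = p
Lang⇒⟦⟧ (E ·ʳ F) (u , v , pu , pv , eq) = split (Lang⇒⟦⟧ E pu) (Lang⇒⟦⟧ F pv) eq
Lang⇒⟦⟧ (E ∨ʳ F) (inj₁ p)              = inj₁ (Lang⇒⟦⟧ E p)
Lang⇒⟦⟧ (E ∨ʳ F) (inj₂ p)              = inj₂ (Lang⇒⟦⟧ F p)
Lang⇒⟦⟧ (E ⋆ʳ) (us , pus , eq)         = us , All.map (Lang⇒⟦⟧ E) pus , eq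

⟦⟧⇒Lang : ∀ α {w} → ⟦ ⌜ α ⌝ ⟧ w → Lang α w
⟦⟧⇒Lang (rvar x) p                 = p
⟦⟧⇒Lang (E ·ʳ F) (split pu pv eq)  = _ , _ , ⟦⟧⇒Lang E pu , ⟦⟧⇒Lang F pv , eq
⟦⟧⇒Lang (E ∨ʳ F) (inj₁ p)          = inj₁ (⟦⟧⇒Lang E p)
⟦⟧⇒Lang (E ∨ʳ F) (inj₂ p)          = inj₂ (⟦⟧⇒Lang F p)
⟦⟧⇒Lang (E ⋆ʳ) (us , pus , eq)     = us , All.map (⟦⟧⇒Lang E) pus , eq

ωLang⇒⟦⟧ : ∀ R {s} → ωLang R s → ⟦ ⌜ R ⌝ω ⟧ s
ωLang⇒⟦⟧ (E ·ʷ R) (u , t , pu , pt , eq) = split (Lang⇒⟦⟧ E pu) (ωLang⇒⟦⟧ R pt) eq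
ωLang⇒⟦⟧ (R ∨ʷ S) (inj₁ p)              = inj₁ (ωLang⇒⟦⟧ R p)
ωLang⇒⟦⟧ (R ∨ʷ S) (inj₂ p)              = inj₂ (ωLang⇒⟦⟧ S p)
ωLang⇒⟦⟧ (E ^ωʷ) {s} (us , pus , us-s)  =
  blocks (Lang⇒⟦⟧ E ∘ proj₁ ∘ pus) (IsConcat⇒IsConcat′ {s = s} us-s)

⟦⟧⇒ωLang : ∀ R {s} → ⟦ ⌜ R ⌝ω ⟧ s → ωLang R s
⟦⟧⇒ωLang (E ·ʷ R) (split pu pt eq) = _ , _ , ⟦⟧⇒Lang E pu , ⟦⟧⇒ωLang R pt , eq
⟦⟧⇒ωLang (R ∨ʷ S) (inj₁ p)         = inj₁ (⟦⟧⇒ωLang R p)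
⟦⟧⇒ωLang (R ∨ʷ S) (inj₂ p)         = inj₂ (⟦⟧⇒ωLang S p)
⟦⟧⇒ωLang (E ^ωʷ) (blocks pus us-s) = ωLang-^ω (⟦⟧⇒Lang E ∘ pus) us-s

-- Soundness

⧵-elim : {P : Word → Set} {A : Fm fin} {B : Fm t} →
         (∀ {w} → P w → ⟦ A ⟧ w) → ∀ {x} → (P ⊗ ⟦ A ⧵ B ⟧) x → ⟦ B ⟧ x
⧵-elim {t} {B = B} h (split {w} p f x≈) = ⟦⟧-closed B (Eq-sym t x≈) (f w (h p))

/-elim : {A D : Fm t} {Q : Obj t → Set} →
         (∀ {y} → Q y → ⟦ D ⟧ y) → ∀ {x} → (⟦ A / D ⟧ ⊗ Q) x → ⟦ A ⟧ x
/-elim {t} {A} h (split {right = y} f q x≈) = ⟦⟧-closed A (Eq-sym t x≈) (f y (h q))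

module _ {A B : Fm fin} {m : Word} where

  ⟦·L⟧ : ⟦ [ A · B ] ⟧* m → ⟦ A ∷ B ∷ [] ⟧* m
  ⟦·L⟧ p = ⊗-map id ⊗ε-intro (⊗ε-elim p)

  ⟦⧵L⟧ : ∀ Π → (∀ {w} → ⟦ Π ⟧* w → ⟦ B ⟧ w) → ⟦ Π ++ [ B ⧵ A ] ⟧* m → ⟦ [ A ] ⟧* m
  ⟦⧵L⟧ Π h p = ⊗ε-intro (⧵-elim h (⊗-map id ⊗ε-elim (⟦++⟧*⁻ Π [ B ⧵ A ] p)))

  ⟦/L⟧ : ∀ Ξ → (∀ {w} → ⟦ Ξ ⟧* w → ⟦ B ⟧ w) → ⟦ A / B ∷ Ξ ⟧* m → ⟦ [ A ] ⟧* m
  ⟦/L⟧ Ξ h p = ⊗ε-intro (/-elim h p)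

  ⟦∧L₁⟧ : ⟦ [ A ∧ B ] ⟧* m → ⟦ [ A ] ⟧* m
  ⟦∧L₁⟧ = ⊗-map proj₁ id

  ⟦∧L₂⟧ : ⟦ [ A ∧ B ] ⟧* m → ⟦ [ B ] ⟧* m
  ⟦∧L₂⟧ = ⊗-map proj₂ id

  ⟦∨L⟧ : ⟦ [ A ∨ B ] ⟧* m → ⟦ [ A ] ⟧* m ⊎ ⟦ [ B ] ⟧* m
  ⟦∨L⟧ (split (inj₁ a) e eq) = inj₁ (split a e eq)
  ⟦∨L⟧ (split (inj₂ b) e eq) = inj₂ (split b e eq)

⟦⧵L⟧* : ∀ Γ Π Θ {A B} → (∀ {w} → ⟦ Π ⟧* w → ⟦ B ⟧ w) →
        ∀ {w} → ⟦ Γ ++ Π ++ B ⧵ A ∷ Θ ⟧* w → ⟦ Γ ++ A ∷ Θ ⟧* w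
⟦⧵L⟧* Γ Π Θ {A} {B} h p = replace* Γ Θ (⟦⧵L⟧ Π h) (subst (λ Δ → ⟦ Γ ++ Δ ⟧* _) (sym (++-assoc Π [ B ⧵ A ] Θ)) p)

⟦⋆L⟧ : ∀ {A m} → ⟦ [ A ⋆ ] ⟧* m → ∃[ n ] ⟦ replicate n A ⟧* m
⟦⋆L⟧ {A} p with ⊗ε-elim p
... | ws , as , refl = length ws , ⟦replicate⟧ as
  where
  ⟦replicate⟧ : ∀ {ws} → All ⟦ A ⟧ ws → ⟦ replicate (length ws) A ⟧* (concat ws)
  ⟦replicate⟧ []       = refl
  ⟦replicate⟧ (a ∷ as) = split a (⟦replicate⟧ as) refl

⟦⋆R⟧ : ∀ {A} n (Π : Fin n → List (Fm fin)) → (∀ i {w} → ⟦ Π i ⟧* w → ⟦ A ⟧ w) →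
       ∀ {w} → ⟦ concat (tabulate Π) ⟧* w → ⟦ A ⋆ ⟧ w
⟦⋆R⟧ zero    Π h refl = [] , [] , refl
⟦⋆R⟧ (suc n) Π h p with ⟦++⟧*⁻ (Π Fin.zero) _ p
... | split {w} pw pv refl = let ws , as , v≡ = ⟦⋆R⟧ n (Π ∘ Fin.suc) (h ∘ Fin.suc) pv in
  w ∷ ws , h Fin.zero pw ∷ as , cong (w ++_) v≡

soundᴸᴰ : ∀ {Γ E} → LD Γ E → ∀ {w} → ⟦ Γ ⟧* w → ⟦ E ⟧ w
soundᴸᴰ (ax A)                         p = ⊗ε-elim p
soundᴸᴰ (·L {Γ} {Θ = Θ} d)             p = soundᴸᴰ d (replace* Γ Θ ⟦·L⟧ p)
soundᴸᴰ (⧵L {Γ} {Π} {Θ = Θ} d e)       p = soundᴸᴰ d (⟦⧵L⟧* Γ Π Θ (soundᴸᴰ e) p)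
soundᴸᴰ (/L {Γ} {Ξ} {Θ = Θ} d e)       p = soundᴸᴰ d (replace* Γ Θ (⟦/L⟧ Ξ (soundᴸᴰ e)) p)
soundᴸᴰ (∧L₁ {Γ} {Θ = Θ} d)            p = soundᴸᴰ d (replace* Γ Θ ⟦∧L₁⟧ p)
soundᴸᴰ (∧L₂ {Γ} {Θ = Θ} d)            p = soundᴸᴰ d (replace* Γ Θ ⟦∧L₂⟧ p)
soundᴸᴰ (∨L {Γ} {A₁} {A₂} {Θ} d₁ d₂)   p =
  let _ , q , back = focus* Γ [ A₁ ∨ A₂ ] Θ p in [ soundᴸᴰ d₁ ∘ back , soundᴸᴰ d₂ ∘ back ]′ (⟦∨L⟧ q)
soundᴸᴰ (⋆L {Γ} {A} {Θ} ds)            p =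
  let _ , q , back = focus* Γ [ A ⋆ ] Θ p ; n , qₙ = ⟦⋆L⟧ q in soundᴸᴰ (ds n) (back {replicate n A} qₙ)

hypothesis-via : ∀ {M M′ P : Pred} {w} → (∀ Ξ → M Ξ ⇔ P Ξ) → (∀ {Ξ} → M′ Ξ → P Ξ) →
         ∃[ Ξ ] (M′ Ξ × ⟦ Ξ ⟧* w) → ∃[ Ξ ] (M Ξ × ⟦ Ξ ⟧* w)
hypothesis-via M⇔ f (Ξ , m , p) = Ξ , Equivalence.from (M⇔ Ξ) (f m) , p

sound⊩ : ∀ {Δ M} → Δ ⊩ M → ∀ {w} → ⟦ Δ ⟧* w → ∃[ Ξ ] (M Ξ × ⟦ Ξ ⟧* w)
sound⊩ (hyp {Θ} M⇔) p = Θ , Equivalence.from (M⇔ Θ) refl , p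
sound⊩ (·L {Γ} {Θ = Θ} d)           p = sound⊩ d (replace* Γ Θ ⟦·L⟧ p)
sound⊩ (⧵L {Γ} {Π} {Θ = Θ} d e)     p = sound⊩ d (⟦⧵L⟧* Γ Π Θ (soundᴸᴰ e) p)
sound⊩ (/L {Γ} {Ξ} {Θ = Θ} d e)     p = sound⊩ d (replace* Γ Θ (⟦/L⟧ Ξ (soundᴸᴰ e)) p)
sound⊩ (∧L₁ {Γ} {Θ = Θ} d)          p = sound⊩ d (replace* Γ Θ ⟦∧L₁⟧ p)
sound⊩ (∧L₂ {Γ} {Θ = Θ} d)          p = sound⊩ d (replace* Γ Θ ⟦∧L₂⟧ p)
sound⊩ (∨L {Γ} {A₁} {A₂} {Θ} d₁ d₂ M⇔) p with focus* Γ [ A₁ ∨ A₂ ] Θ p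
... | _ , q , back with ⟦∨L⟧ q
...   | inj₁ q₁ = hypothesis-via M⇔ inj₁ (sound⊩ d₁ (back q₁))
...   | inj₂ q₂ = hypothesis-via M⇔ inj₂ (sound⊩ d₂ (back q₂))
sound⊩ (⋆L {Γ} {A} {Θ} Ms ds M⇔) p =
  let _ , q , back = focus* Γ [ A ⋆ ] Θ p ; n , qₙ = ⟦⋆L⟧ q in
  hypothesis-via M⇔ (n ,_) (sound⊩ (ds n) (back {replicate n A} qₙ))

-- A chosen hypothesis is empty only over an empty block, so the chosen hypotheses still cover.
⟦Lω⟧ : {Δ : Stream (List (Fm fin))} {M : ℕ → Pred} {f : Stream (Fm fin)} {x : ωWord} →
       IsConcat Δ f → (∀ i → Δ i ⊩ M i) → ⟦ ⟪ f ⟫ω ⟧ᴬ x →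
       Σ[ g ∈ Stream (List (Fm fin)) ] ((∀ i → M i (g i)) ×
         Σ[ h ∈ Stream (Fm fin) ] (IsConcat g h × ⟦ ⟪ h ⟫ω ⟧ᴬ x))
⟦Lω⟧ {M = M} {f} Δf ds p =
  g , proj₁ ∘ proj₂ ∘ chosen , flatten g cg , IsConcat′⇒IsConcat (IsConcat′-flatten cg) ,
  ⨂-ungroup (IsConcat′-flatten cg) (blocks (proj₂ ∘ proj₂ ∘ chosen) (words-s grouped))
  where
  grouped = ⨂-group (IsConcat⇒IsConcat′ {s = f} Δf) p
  chosen : ∀ k → ∃[ Ξ ] (M k Ξ × ⟦ Ξ ⟧* (words grouped k))
  chosen k = sound⊩ (ds k) (words∈ grouped k)
  g : Stream (List (Fm fin))
  g = proj₁ ∘ chosen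
  cg : Covering g
  cg = Covering-transfer (λ k g≡[] → subst (λ Ξ → ⟦ Ξ ⟧* _) g≡[] (proj₂ (proj₂ (chosen k))))
                         (covering (words-s grouped))

Valid : Sequent → Set
Valid (Θ ⊢ C) = ∀ {x} → ⟦ Θ ⟧ᴬ x → ⟦ C ⟧ x

sound : ∀ {S} → Der S → Valid S
sound (ax {fin} A)                      p = ⊗ε-elim p
sound (ax {omg} A)                      p = ε⊗-elim (⟦⟧-closed A) p
sound (·L {Γ = Γ} {Θ = Θ} d)            p = sound d (replace Γ Θ ⟦·L⟧ p)
sound (⧵L {Γ = Γ} {Π} {Θ = Θ} d e)      p = sound d (replace Γ Θ (⟦⧵L⟧ Π (sound e)) p)
sound (/L {Γ = Γ} {Ξ} {Θ = Θ} d e)      p = sound d (replace Γ Θ (⟦/L⟧ Ξ (sound e)) p)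
sound (∧L₁ {Γ = Γ} {Θ = Θ} d)           p = sound d (replace Γ Θ ⟦∧L₁⟧ p)
sound (∧L₂ {Γ = Γ} {Θ = Θ} d)           p = sound d (replace Γ Θ ⟦∧L₂⟧ p)
sound (∨L {Γ = Γ} {A₁} {A₂} {Θ} d₁ d₂)  p =
  let _ , q , back = focus Γ [ A₁ ∨ A₂ ] Θ p in [ sound d₁ ∘ back , sound d₂ ∘ back ]′ (⟦∨L⟧ q)
sound (⋆L {Γ = Γ} {A} {Θ} ds)           p =
  let _ , q , back = focus Γ [ A ⋆ ] Θ p ; n , qₙ = ⟦⋆L⟧ q in sound (ds n) (back {replicate n A} qₙ)
sound (/Lω {Γ} {A} {D} {Ξ} d e)         p =
  sound d (⊗-map id (/-elim (sound e) ∘ ⊗-map ⊗ε-elim id) (⟦prepend-++⟧⁻ Γ [ A / D ] Ξ p))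
sound (·Lω {Γ} {A} d)                   p =
  sound d (⊗-map (⟦++⟧*⁺ Γ [ A ] ∘ ⊗-map id ⊗ε-intro) id (⊗-assoc⁻ p))
sound (⧵Lω {Γ} {Π} d e)                 p =
  sound d (⊗-map id (⧵-elim (sound e)) (⊗-assoc⁺ (⊗-map (⟦++⟧*⁻ Γ Π) id p)))
sound (∧L₁ω d)                          p = sound d (⊗-map id proj₁ p)
sound (∧L₂ω d)                          p = sound d (⊗-map id proj₂ p)
sound (∨Lω d₁ d₂) (split pw (inj₁ a) eq)  = sound d₁ (split pw a eq)
sound (∨Lω d₁ d₂) (split pw (inj₂ b) eq)  = sound d₂ (split pw b eq)
sound (^ωL {Γ} {A} d)                   p = sound d (⟦prepend⟧⁺ Γ ⟪ (λ _ → A) ⟫ω p)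
sound (Lω Δ M ds prem Δf)               p =
  let g , g∈M , h , g-h , ph = ⟦Lω⟧ Δf ds p in sound (prem g g∈M h g-h) ph
sound (^ωR Γ ds Γf)                     p =
  let blocks pvs vs-x = ⨂-group (IsConcat⇒IsConcat′ Γf) p in blocks (λ k → sound (ds k) (pvs k)) vs-x
sound (/R {fin} {Π} {B = B} d) p y b = sound d (⟦++⟧*⁺ Π [ B ] (split p (⊗ε-intro b) refl))
sound (/R {omg} d)             p y b = sound d (split p b (λ _ → refl))
sound (⧵R {t} {B} {Θ} d)       p w b = sound d (⟦prepend⟧⁺ [ B ] Θ (split (⊗ε-intro b) p (Eq-refl t)))
sound (·R {Γ = Γ} {Θ = Θ} d₁ d₂) p = ⊗-map (sound d₁) (sound d₂) (⟦prepend⟧⁻ Γ Θ p)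
sound (∧R d₁ d₂) p = sound d₁ p , sound d₂ p
sound (∨R₁ d)    p = inj₁ (sound d p)
sound (∨R₂ d)    p = inj₂ (sound d p)
sound (⋆R n Π ds) p = ⟦⋆R⟧ n Π (sound ∘ ds) p
sound (ext d f≗g) (blocks pus us-x) =
  sound d (blocks (λ n → subst (λ A → ⟦ A ⟧ _) (sym (f≗g n)) (pus n)) us-x)

-- Completeness

castΓ : ∀ {Γ Γ′} {Θ : Ante t} {C : Fm t} → Γ ≡ Γ′ → Der (prepend Γ Θ ⊢ C) → Der (prepend Γ′ Θ ⊢ C)
castΓ refl d = d

Der-++⁺ : ∀ Γ Δ (Θ : Ante t) {C} → Der (prepend Γ (prepend Δ Θ) ⊢ C) → Der (prepend (Γ ++ Δ) Θ ⊢ C)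
Der-++⁺ Γ Δ ⟪ Θ ⟫     = subst (λ Ξ → Der (⟪ Ξ ⟫ ⊢ _)) (sym (++-assoc Γ Δ Θ))
Der-++⁺ Γ Δ ⟪ Θ ∣ D ⟫ = subst (λ Ξ → Der (⟪ Ξ ∣ D ⟫ ⊢ _)) (sym (++-assoc Γ Δ Θ))
Der-++⁺ Γ Δ ⟪ f ⟫ω d  = ext d (sym ∘ ++ˢ-assoc Γ Δ f)

Der-++⁻ : ∀ Γ Δ (Θ : Ante t) {C} → Der (prepend (Γ ++ Δ) Θ ⊢ C) → Der (prepend Γ (prepend Δ Θ) ⊢ C)
Der-++⁻ Γ Δ ⟪ Θ ⟫     = subst (λ Ξ → Der (⟪ Ξ ⟫ ⊢ _)) (++-assoc Γ Δ Θ)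
Der-++⁻ Γ Δ ⟪ Θ ∣ D ⟫ = subst (λ Ξ → Der (⟪ Ξ ∣ D ⟫ ⊢ _)) (++-assoc Γ Δ Θ)
Der-++⁻ Γ Δ ⟪ f ⟫ω d  = ext d (++ˢ-assoc Γ Δ f)

++-map-var : ∀ (Γ : List (Fm fin)) u v → Γ ++ map var (u ++ v) ≡ (Γ ++ map var u) ++ map var v
++-map-var Γ u v = trans (cong (Γ ++_) (map-++ var u v)) (sym (++-assoc Γ (map var u) (map var v)))

concat-tabulate-map-var : (us : List Word) → concat (tabulate (map var ∘ lookup us)) ≡ map var (concat us)
concat-tabulate-map-var us = begin
  concat (tabulate (map var ∘ lookup us))     ≡⟨ cong concat (map-tabulate (lookup us) (map var)) ⟨
  concat (map (map var) (tabulate (lookup us))) ≡⟨ cong (concat ∘ map (map var)) (tabulate-lookup us) ⟩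
  concat (map (map var) us)                   ≡⟨ concat-map us ⟩
  map var (concat us)                         ∎
  where open ≡-Reasoning

regR : ∀ β {w} → Lang β w → Der (⟪ map var w ⟫ ⊢ ⌜ β ⌝)
regR (rvar x) refl                     = ax (var x)
regR (E ·ʳ F) (u , v , pu , pv , refl) =
  subst (λ Γ → Der (⟪ Γ ⟫ ⊢ _)) (sym (map-++ var u v)) (·R (regR E pu) (regR F pv))
regR (E ∨ʳ F) (inj₁ p)                 = ∨R₁ (regR E p)
regR (E ∨ʳ F) (inj₂ p)                 = ∨R₂ (regR F p)
regR (E ⋆ʳ) (us , pus , refl)          =
  subst (λ Γ → Der (⟪ Γ ⟫ ⊢ _)) (concat-tabulate-map-var us)
        (⋆R (length us) (map var ∘ lookup us) (λ i → regR E (All.lookup pus (∈-lookup i))))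

mutual
  regL : ∀ α Γ (Θ : Ante t) {C} → (∀ {w} → Lang α w → Der (prepend (Γ ++ map var w) Θ ⊢ C)) →
         Der (prepend (Γ ++ [ ⌜ α ⌝ ]) Θ ⊢ C)
  regL (rvar x) Γ Θ k = k refl
  regL (E ·ʳ F) Γ Θ k =
    ·L (castΓ (++-assoc Γ [ ⌜ E ⌝ ] [ ⌜ F ⌝ ])
      (regL F (Γ ++ [ ⌜ E ⌝ ]) Θ λ {v} pv → regL-prefix E Γ v Θ λ {u} pu → k (u , v , pu , pv , refl)))
  regL (E ∨ʳ F) Γ Θ k = ∨L (regL E Γ Θ (k ∘ inj₁)) (regL F Γ Θ (k ∘ inj₂))
  regL (E ⋆ʳ)   Γ Θ {C} k = ⋆L λ n → powers n Γ λ pus → k (_ , pus , refl)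
    where
    powers : ∀ n Γ → (∀ {us} → All (Lang E) us → Der (prepend (Γ ++ map var (concat us)) Θ ⊢ C)) →
             Der (prepend (Γ ++ replicate n ⌜ E ⌝) Θ ⊢ C)
    powers zero    Γ k = k []
    powers (suc n) Γ k = castΓ (++-assoc Γ [ ⌜ E ⌝ ] (replicate n ⌜ E ⌝))
      (powers n (Γ ++ [ ⌜ E ⌝ ]) λ {us} pus → regL-prefix E Γ (concat us) Θ λ pu → k (pu ∷ pus))

  regL-prefix : ∀ E Γ v (Θ : Ante t) {C} → (∀ {u} → Lang E u → Der (prepend (Γ ++ map var (u ++ v)) Θ ⊢ C)) →
                Der (prepend ((Γ ++ [ ⌜ E ⌝ ]) ++ map var v) Θ ⊢ C)
  regL-prefix E Γ v Θ k =
    Der-++⁺ (Γ ++ [ ⌜ E ⌝ ]) (map var v) Θ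
      (regL E Γ (prepend (map var v) Θ) λ {u} pu →
        Der-++⁻ (Γ ++ map var u) (map var v) Θ (castΓ (++-map-var Γ u v) (k pu)))

⊩-resp : ∀ {Δ} {M M′ : Pred} → (∀ Ξ → M Ξ ⇔ M′ Ξ) → Δ ⊩ M → Δ ⊩ M′
⊩-resp M⇔ (hyp e)      = hyp (λ Ξ → ⇔-trans (⇔-sym (M⇔ Ξ)) (e Ξ))
⊩-resp M⇔ (·L d)       = ·L (⊩-resp M⇔ d)
⊩-resp M⇔ (⧵L d e)     = ⧵L (⊩-resp M⇔ d) e
⊩-resp M⇔ (/L d e)     = /L (⊩-resp M⇔ d) e
⊩-resp M⇔ (∧L₁ d)      = ∧L₁ (⊩-resp M⇔ d)
⊩-resp M⇔ (∧L₂ d)      = ∧L₂ (⊩-resp M⇔ d)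
⊩-resp M⇔ (∨L d₁ d₂ e) = ∨L d₁ d₂ (λ Ξ → ⇔-trans (⇔-sym (M⇔ Ξ)) (e Ξ))
⊩-resp M⇔ (⋆L Ms ds e) = ⋆L Ms ds (λ Ξ → ⇔-trans (⇔-sym (M⇔ Ξ)) (e Ξ))

cast⊩ : ∀ {Δ Δ′} {M : Pred} → Δ ≡ Δ′ → Δ ⊩ M → Δ′ ⊩ M
cast⊩ refl d = d

mutual
  regL⊩ : ∀ α Γ Θ (N : Word → Pred) → (∀ {w} → Lang α w → (Γ ++ map var w ++ Θ) ⊩ N w) →
          (Γ ++ ⌜ α ⌝ ∷ Θ) ⊩ (λ Ξ → ∃[ w ] (Lang α w × N w Ξ))
  regL⊩ (rvar x) Γ Θ N k =
    ⊩-resp (λ Ξ → mk⇔ (λ n → [ x ] , refl , n) (λ { (_ , refl , n) → n })) (k refl)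
  regL⊩ (E ·ʳ F) Γ Θ N k =
    ⊩-resp (λ Ξ → mk⇔ (λ { (v , pv , u , pu , n) → u ++ v , (u , v , pu , pv , refl) , n })
                      (λ { (_ , (u , v , pu , pv , refl) , n) → v , pv , u , pu , n }))
      (·L (cast⊩ (++-assoc Γ [ ⌜ E ⌝ ] (⌜ F ⌝ ∷ Θ))
        (regL⊩ F (Γ ++ [ ⌜ E ⌝ ]) Θ (λ v Ξ → ∃[ u ] (Lang E u × N (u ++ v) Ξ)) λ {v} pv →
          regL⊩-prefix E Γ v Θ (λ u → N (u ++ v)) λ {u} pu → k (u , v , pu , pv , refl))))
  regL⊩ (E ∨ʳ F) Γ Θ N k =
    ∨L (regL⊩ E Γ Θ N (k ∘ inj₁)) (regL⊩ F Γ Θ N (k ∘ inj₂))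
       (λ Ξ → mk⇔ (λ { (w , inj₁ p , n) → inj₁ (w , p , n) ; (w , inj₂ p , n) → inj₂ (w , p , n) })
                  (λ { (inj₁ (w , p , n)) → w , inj₁ p , n ; (inj₂ (w , p , n)) → w , inj₂ p , n }))
  regL⊩ (E ⋆ʳ) Γ Θ N k =
    ⋆L _ (λ n → powers n Γ (N ∘ concat) λ pus _ → k (_ , pus , refl))
       (λ Ξ → mk⇔ (λ { (_ , (us , pus , refl) , n) → length us , us , pus , refl , n })
                  (λ { (_ , us , pus , _ , n) → concat us , (us , pus , refl) , n }))
    where
    powers : ∀ n Γ (N : List Word → Pred) →
             (∀ {us} → All (Lang E) us → length us ≡ n → (Γ ++ map var (concat us) ++ Θ) ⊩ N us) →
             (Γ ++ replicate n ⌜ E ⌝ ++ Θ) ⊩ (λ Ξ → ∃[ us ] (All (Lang E) us × length us ≡ n × N us Ξ))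
    powers zero    Γ N k =
      ⊩-resp (λ Ξ → mk⇔ (λ n → [] , [] , refl , n) (λ { ([] , [] , refl , n) → n })) (k [] refl)
    powers (suc n) Γ N k =
      ⊩-resp (λ Ξ → mk⇔ (λ { (us , pus , len , u , pu , m) → u ∷ us , pu ∷ pus , cong suc len , m })
                        (λ { (u ∷ us , pu ∷ pus , len , m) → us , pus , suc-injective len , u , pu , m }))
        (cast⊩ (++-assoc Γ [ ⌜ E ⌝ ] (replicate n ⌜ E ⌝ ++ Θ))
          (powers n (Γ ++ [ ⌜ E ⌝ ]) (λ us Ξ → ∃[ u ] (Lang E u × N (u ∷ us) Ξ)) λ {us} pus len →
            regL⊩-prefix E Γ (concat us) Θ (λ u → N (u ∷ us)) λ pu → k (pu ∷ pus) (cong suc len)))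

  regL⊩-prefix : ∀ E Γ v Θ (N : Word → Pred) → (∀ {u} → Lang E u → (Γ ++ map var (u ++ v) ++ Θ) ⊩ N u) →
                 ((Γ ++ [ ⌜ E ⌝ ]) ++ map var v ++ Θ) ⊩ (λ Ξ → ∃[ u ] (Lang E u × N u Ξ))
  regL⊩-prefix E Γ v Θ N k =
    cast⊩ (sym (++-assoc Γ [ ⌜ E ⌝ ] (map var v ++ Θ)))
      (regL⊩ E Γ (map var v ++ Θ) N λ {u} pu →
        cast⊩ (cong (Γ ++_) (trans (cong (_++ Θ) (map-++ var u v)) (++-assoc (map var u) (map var v) Θ))) (k pu))

ωregR : ∀ β {s} → ωLang β s → Der (⟪ var ∘ s ⟫ω ⊢ ⌜ β ⌝ω)
ωregR (E ·ʷ R) (u , t , pu , pt , s≗) =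
  ext (·R {Θ = ⟪ var ∘ t ⟫ω} (regR E pu) (ωregR R pt))
      (λ n → trans (map-++ˢ var u t n) (cong var (sym (s≗ n))))
ωregR (R ∨ʷ S) (inj₁ p) = ∨R₁ (ωregR R p)
ωregR (R ∨ʷ S) (inj₂ p) = ∨R₂ (ωregR S p)
ωregR (E ^ωʷ) {s} (us , pus , us-s) =
  ^ωR (map var ∘ us) (λ i → regR E (proj₁ (pus i)))
      (IsConcat′⇒IsConcat (IsConcat′-map var (IsConcat⇒IsConcat′ {s = s} us-s)))

ωregL : ∀ R Γ {C} → (∀ {s} → ωLang R s → Der (⟪ Γ ++ˢ (var ∘ s) ⟫ω ⊢ C)) → Der (⟪ Γ ∣ ⌜ R ⌝ω ⟫ ⊢ C)
ωregL (E ·ʷ R) Γ {C} k =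
  ·Lω (castω (++-identityʳ _) (regL E Γ ⟪ [] ∣ ⌜ R ⌝ω ⟫ λ {u} pu →
    castω (sym (++-identityʳ _)) (ωregL R (Γ ++ map var u) λ {t} pt →
      ext (k (u , t , pu , pt , λ _ → refl))
          (λ n → trans (++ˢ-cong Γ (sym ∘ map-++ˢ var u t) n) (sym (++ˢ-assoc Γ (map var u) (var ∘ t) n))))))
  where
  castω : ∀ {Ξ Ξ′} → Ξ ≡ Ξ′ → Der (⟪ Ξ ∣ ⌜ R ⌝ω ⟫ ⊢ C) → Der (⟪ Ξ′ ∣ ⌜ R ⌝ω ⟫ ⊢ C)
  castω refl d = d
ωregL (R ∨ʷ S) Γ k = ∨Lω (ωregL R Γ (k ∘ inj₁)) (ωregL S Γ (k ∘ inj₂))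
ωregL (E ^ωʷ) Γ {C} k = ^ωL (Lω Δ M Δ⊩M prem (IsConcat′⇒IsConcat Δ-f))
  where
  Δ : Stream (List (Fm fin))
  Δ = Γ ∷ˢ const [ ⌜ E ⌝ ]
  M : ℕ → Pred
  M zero    Ξ = Ξ ≡ Γ
  M (suc i) Ξ = ∃[ w ] (Lang E w × Ξ ≡ map var w ++ [])
  Δ⊩M : ∀ i → Δ i ⊩ M i
  Δ⊩M zero    = hyp (λ _ → mk⇔ id id)
  Δ⊩M (suc i) = regL⊩ E [] [] (λ w → _≡ map var w ++ []) (λ _ → hyp (λ _ → mk⇔ id id))
  Δ-f : IsConcat′ Δ (Γ ++ˢ const ⌜ E ⌝)
  Δ-f = IsConcat′-∷⁺ (λ _ → refl) (IsConcat′-singletons (const ⌜ E ⌝))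
  prem : ∀ g → (∀ i → M i (g i)) → ∀ h → IsConcat g h → Der (⟪ h ⟫ω ⊢ C)
  prem g g∈M h g-h =
    let h≗ , tail-h = IsConcat′-∷⁻ (IsConcat⇒IsConcat′ {s = h} g-h)
        s , ws-s , tail≗ = IsConcat′-map⁻ var (IsConcat′-cong vars tail-h)
    in ext (k (ωLang-^ω (proj₁ ∘ proj₂ ∘ g∈M ∘ suc) ws-s))
           (λ n → sym (trans (h≗ n) (trans (cong (λ Ξ → (Ξ ++ˢ _) n) (g∈M 0)) (++ˢ-cong Γ tail≗ n))))
    where
    vars : ∀ i → g (suc i) ≡ map var (proj₁ (g∈M (suc i)))
    vars i = trans (proj₂ (proj₂ (g∈M (suc i)))) (++-identityʳ _)

regexp-complete : ∀ α β → (∀ w → Lang α w → Lang β w) → Der (⟪ [ ⌜ α ⌝ ] ⟫ ⊢ ⌜ β ⌝)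
regexp-complete α β α⊆β = regL α [] ⟪ [] ⟫ λ {w} p →
  subst (λ Γ → Der (⟪ Γ ⟫ ⊢ ⌜ β ⌝)) (sym (++-identityʳ (map var w))) (regR β (α⊆β w p))

regexp-sound : ∀ α β → Der (⟪ [ ⌜ α ⌝ ] ⟫ ⊢ ⌜ β ⌝) → ∀ w → Lang α w → Lang β w
regexp-sound α β d w p = ⟦⟧⇒Lang β (sound d (⊗ε-intro (Lang⇒⟦⟧ α p)))

ωregexp-complete : ∀ α β → (∀ s → ωLang α s → ωLang β s) → Der (⟪ [] ∣ ⌜ α ⌝ω ⟫ ⊢ ⌜ β ⌝ω)
ωregexp-complete α β α⊆β = ωregL α [] λ {s} p → ωregR β (α⊆β s p)

ωregexp-sound : ∀ α β → Der (⟪ [] ∣ ⌜ α ⌝ω ⟫ ⊢ ⌜ β ⌝ω) → ∀ s → ωLang α s → ωLang β s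
ωregexp-sound α β d s p = ⟦⟧⇒ωLang β (sound d (ε⊗-intro (ωLang⇒⟦⟧ α p)))

mainTheorem2 :
    (∀ (α β : RegExp) →
      ((∀ w → Lang α w → Lang β w) ⇔ Der (⟪ [ ⌜ α ⌝ ] ⟫ ⊢ ⌜ β ⌝)))
    ×
    (∀ (α β : ωRegExp) →
      ((∀ s → ωLang α s → ωLang β s) ⇔ Der (⟪ [] ∣ ⌜ α ⌝ω ⟫ ⊢ ⌜ β ⌝ω)))
mainTheorem2 =
  (λ α β → mk⇔ (regexp-complete α β) (regexp-sound α β)) ,
  (λ α β → mk⇔ (ωregexp-complete α β) (ωregexp-sound α β))
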